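{- Let $(C_2, e)$ be the multigraph with $2$ vertices and $2$ parallel edges joining them, one of which, $e$, is distinguished. Then every element of $\mathcal{G}'$ can be obtained from $(C_2, e)$ by a finite sequence of the following operations: loop addition, leaf addition, edge duplication, and edge subdivision.
   Context: Multigraphs may have loops and parallel edges. A series-parallel graph is a multigraph with no $K_4$ minor. $\mathcal{G}'$ is the set of pairs $(G,e)$ where $G$ is a connected series-parallel multigraph and $e \in E(G)$ is a distinguished edge that is neither a bridge nor a loop. The operations on $(G,e)$ are: loop addition (add a loop at some vertex; the loop is undistinguished); leaf addition (add a new vertex joined to an existing vertex by a new undistinguished edge); edge duplication (replace an undistinguished edge by two parallel edges with the same endpoints); edge subdivision (replace an undistinguished edge by a path of length $2$ through a new vertex). The distinguished edge is kept throughout. -}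

module Defs where

open import Data.Nat using (ℕ; zero; suc)
open import Data.Fin using (Fin; zero; suc)
open import Data.Product using (Σ; ∃; _×_; _,_; proj₁; proj₂)
open import Data.Sum using (_⊎_)
open import Data.Maybe using (Maybe; just)
open import Data.Unit using (⊤)
open import Function.Bundles using (_↔_; Inverse)
open import Relation.Binary.PropositionalEquality using (_≡_; _≢_)
open import Relation.Nullary using (¬_)

-- Vertices are Fin nV, edges are Fin nE; each edge has an (unordered)
-- pair of end vertices, recorded as an ordered pair whose orientation
-- is irrelevant everywhere below.

record Graph : Set where
  field
    nV   : ℕ
    nE   : ℕ
    ends : Fin nE → Fin nV × Fin nV
open Graph public

Joins : (G : Graph) → Fin (nE G) → Fin (nV G) → Fin (nV G) → Set
Joins G i u w = (ends G i ≡ (u , w)) ⊎ (ends G i ≡ (w , u))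

-- Walks from u to v all of whose vertices satisfy VOk and all of whose
-- edges satisfy EOk (used for induced subgraphs / edge deletion).
data Walk (G : Graph) (VOk : Fin (nV G) → Set) (EOk : Fin (nE G) → Set)
     : Fin (nV G) → Fin (nV G) → Set where
  here : ∀ {u} → VOk u → Walk G VOk EOk u u
  step : ∀ {u w v} (i : Fin (nE G)) → EOk i → Joins G i u w → VOk u →
         Walk G VOk EOk w v → Walk G VOk EOk u v

AllV : (G : Graph) → Fin (nV G) → Set
AllV G _ = ⊤

AllE : (G : Graph) → Fin (nE G) → Set
AllE G _ = ⊤

Connected : Graph → Set
Connected G = Fin (nV G) × (∀ u v → Walk G (AllV G) (AllE G) u v)

IsLoop : (G : Graph) → Fin (nE G) → Set
IsLoop G e = proj₁ (ends G e) ≡ proj₂ (ends G e)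

-- e is a bridge: deleting e disconnects its two ends
-- (equivalently, deleting e increases the number of components)
IsBridge : (G : Graph) → Fin (nE G) → Set
IsBridge G e = ¬ Walk G (AllV G) (λ i → i ≢ e) (proj₁ (ends G e)) (proj₂ (ends G e))

-- K₄ minors, via minor models (branch sets): a partial labelling of the
-- vertices by Fin 4 (so the branch sets are automatically disjoint) such
-- that every branch set is nonempty and connected in the subgraph it
-- induces, and any two distinct branch sets are joined by an edge.

record K4Model (G : Graph) : Set where
  field
    branch    : Fin (nV G) → Maybe (Fin 4)
    nonempty  : (a : Fin 4) → Σ (Fin (nV G)) λ v → branch v ≡ just a
    connected : (a : Fin 4) → ∀ u v → branch u ≡ just a → branch v ≡ just a →
                Walk G (λ x → branch x ≡ just a) (AllE G) u v
    adjacent  : (a b : Fin 4) → a ≢ b →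
                Σ (Fin (nE G)) λ i → Σ (Fin (nV G)) λ u → Σ (Fin (nV G)) λ w →
                  Joins G i u w × branch u ≡ just a × branch w ≡ just b

HasK4Minor : Graph → Set
HasK4Minor G = K4Model G

SeriesParallel : Graph → Set
SeriesParallel G = ¬ HasK4Minor G

record Pointed : Set where
  field
    graph : Graph
    dist  : Fin (nE graph)
open Pointed public

InG′ : Pointed → Set
InG′ P = Connected (graph P) × SeriesParallel (graph P)
       × ¬ IsBridge (graph P) (dist P) × ¬ IsLoop (graph P) (dist P)

SameEnds : ∀ {A : Set} → A × A → A × A → Set
SameEnds (a , b) (c , d) = ((a ≡ c) × (b ≡ d)) ⊎ ((a ≡ d) × (b ≡ c))

mapPair : ∀ {A B : Set} → (A → B) → A × A → B × B
mapPair f (a , b) = (f a , f b)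

record Iso (P Q : Pointed) : Set where
  field
    vIso  : Fin (nV (graph P)) ↔ Fin (nV (graph Q))
    eIso  : Fin (nE (graph P)) ↔ Fin (nE (graph Q))
    ends≅ : ∀ i → SameEnds (ends (graph Q) (Inverse.to eIso i))
                           (mapPair (Inverse.to vIso) (ends (graph P) i))
    dist≅ : Inverse.to eIso (dist P) ≡ dist Q

-- The four operations. New edges / new vertices are placed at index
-- zero and old ones are shifted by suc (the position is immaterial, as
-- everything is compared up to isomorphism).

addLoop : (P : Pointed) → Fin (nV (graph P)) → Pointed
addLoop P v = record
  { graph = record { nV = nV G ; nE = suc (nE G) ; ends = f }
  ; dist  = suc (dist P) }
  where
  G = graph P
  f : Fin (suc (nE G)) → Fin (nV G) × Fin (nV G)
  f zero    = (v , v)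
  f (suc i) = ends G i

addLeaf : (P : Pointed) → Fin (nV (graph P)) → Pointed
addLeaf P v = record
  { graph = record { nV = suc (nV G) ; nE = suc (nE G) ; ends = f }
  ; dist  = suc (dist P) }
  where
  G = graph P
  f : Fin (suc (nE G)) → Fin (suc (nV G)) × Fin (suc (nV G))
  f zero    = (zero , suc v)
  f (suc i) = mapPair suc (ends G i)

duplicate : (P : Pointed) → Fin (nE (graph P)) → Pointed
duplicate P j = record
  { graph = record { nV = nV G ; nE = suc (nE G) ; ends = f }
  ; dist  = suc (dist P) }
  where
  G = graph P
  f : Fin (suc (nE G)) → Fin (nV G) × Fin (nV G)
  f zero    = ends G j
  f (suc i) = ends G i

-- edge subdivision of the (undistinguished) edge j = xy: j becomes x–z
-- and a new edge z–y is added, z being a new vertex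
subdivide : (P : Pointed) → Fin (nE (graph P)) → Pointed
subdivide P j = record
  { graph = record { nV = suc (nV G) ; nE = suc (nE G) ; ends = f }
  ; dist  = suc (dist P) }
  where
  G = graph P
  f : Fin (suc (nE G)) → Fin (suc (nV G)) × Fin (suc (nV G))
  f zero = (zero , suc (proj₂ (ends G j)))
  f (suc i) with i Data.Fin.≟ j
  ... | Relation.Nullary.yes _ = (suc (proj₁ (ends G j)) , zero)
  ... | Relation.Nullary.no  _ = mapPair suc (ends G i)

data Step : Pointed → Pointed → Set where
  loopAdd  : ∀ P v → Step P (addLoop P v)
  leafAdd  : ∀ P v → Step P (addLeaf P v)
  dupl     : ∀ P j → j ≢ dist P → Step P (duplicate P j)
  subdiv   : ∀ P j → j ≢ dist P → Step P (subdivide P j)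

data Steps : Pointed → Pointed → Set where
  done : ∀ {P} → Steps P P
  _then_ : ∀ {P Q R} → Step P Q → Steps Q R → Steps P R

C₂e : Pointed
C₂e = record
  { graph = record { nV = 2 ; nE = 2 ; ends = λ _ → (zero , suc zero) }
  ; dist  = zero }

ObtainableFrom : Pointed → Pointed → Set
ObtainableFrom P Q = Σ Pointed λ R → Steps Q R × Iso R P

{-# OPTIONS --safe #-}
module Submission where

-- Induction on the number of edges. If G has an undistinguished loop, two parallel undistinguished
-- edges, a leaf, or a vertex of degree two off the distinguished edge e = uv, then G arises by one of
-- the four operations from a graph with one edge less. That graph is again in 𝒢′: the operation is
-- undone by deleting an edge or contracting the connected fibres of a vertex map, which keeps the
-- graph connected and free of K₄ minors and e neither a loop nor a bridge. Otherwise every vertex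
-- other than u and v has three distinct neighbours, and then a vertex besides u and v would give a
-- K₄ minor; so G has just the vertices u and v and, besides e, exactly one edge uv: it is (C₂, e).
--
-- The K₄ minor comes from an induction on pieces: vertex sets S attached to the rest of the graph only
-- at two terminals a and b, together with an a–b connection outside S. Either a part of S hangs off a
-- single vertex and is a smaller piece, or there is an a–b path through S. If the path misses a vertex
-- of S, that vertex lies in a bridge of the path: a bridge with at most two attachments is a smaller
-- piece, and one with three attachments yields the four branch sets. If the path covers S, a chord at
-- its second vertex shortens it and leaves a vertex off it.

open import Defs
open import Data.Bool using (if_then_else_)
open import Data.Empty using (⊥; ⊥-elim)
open import Data.Fin using (Fin; zero; suc; _≟_; punchIn; punchOut)
open import Data.Fin.Permutation as Perm using (Permutation′; lift₀; transpose; insert; insert-punchIn; _⟨$⟩ʳ_)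
import Data.Fin.Permutation.Components as PC
open import Data.Fin.Properties using (any?; all?; punchIn-punchOut; punchIn-injective; punchInᵢ≢i; punchOut-injective)
open import Data.Fin.Subset using (Subset; Side; inside; outside; _⊆_; _⊂_; _⊃_; _∪_; ⁅_⁆; ⊤)
  renaming (_∈_ to _∈ₛ_; _∉_ to _∉ₛ_)
open import Data.Fin.Subset.Induction using (⊂-wellFounded; ⊃-wellFounded)
open import Data.Fin.Subset.Properties using (x∈p∪q⁺; x∈p∪q⁻; x∈⁅x⁆; x∈⁅y⁆⇒x≡y; _∈?_; ∈⊤)
open import Data.List using (List; []; _∷_; _++_)
open import Data.List.Membership.Propositional using (_∈_; _∉_)
open import Data.List.Membership.Propositional.Properties using (∈-++⁺ˡ; ∈-++⁺ʳ; ∈-++⁻; ∈-∃++)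
open import Data.List.Properties using (++-assoc)
open import Data.List.Relation.Unary.All as All using (All; []; _∷_)
open import Data.List.Relation.Unary.All.Properties using (¬Any⇒All¬) renaming (++⁻ʳ to All-++⁻ʳ; ++⁺ to All-++⁺)
open import Data.List.Relation.Unary.Any using (here; there)
open import Data.List.Relation.Unary.First as First using (first)
open import Data.List.Relation.Unary.First.Properties using (toView)
open import Data.List.Relation.Unary.Linked as Linked using (Linked; []; [-]; _∷_)
open import Data.List.Relation.Unary.Unique.Propositional as Unique using (Unique; []; _∷_)
open import Data.List.Relation.Unary.Unique.Propositional.Properties using (Unique[x∷xs]⇒x∉xs) renaming (++⁺ to Unique-++⁺)
open import Data.Maybe using (Maybe; just; nothing)
open import Data.Nat using (ℕ; zero; suc; _<_)
open import Data.Nat.Induction using (<-wellFounded)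
open import Data.Nat.Properties using (n<1+n)
open import Data.Product using (Σ; ∃; ∃₂; _×_; _,_; proj₁; proj₂)
open import Data.Product.Properties using (≡-dec)
open import Data.Sum as Sum using (_⊎_; inj₁; inj₂)
open import Data.Unit using (tt)
open import Data.Vec using (tabulate)
open import Data.Vec.Properties using (lookup∘tabulate; lookup⇒[]=; []=⇒lookup)
open import Function using (_∘_; id)
open import Function.Bundles using (_↔_; Inverse; mk↔ₛ′)
open import Function.Properties.Inverse using (↔-sym; ↔-trans)
open import Induction.WellFounded using (Acc; acc)
open import Relation.Binary.PropositionalEquality using (_≡_; _≢_; refl; sym; trans; cong; cong₂; subst; subst₂)
open import Relation.Nullary using (¬_; Dec; yes; no; does)
import Relation.Nullary.Decidable as Dec
open import Relation.Nullary.Decidable using (_⊎-dec_; _×-dec_; _→-dec_; ¬?; dec-true; dec-false; decidable-stable)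
open import Relation.Unary using (Decidable)

private
  variable
    A B : Set

SameEnds-refl : (p : A × A) → SameEnds p p
SameEnds-refl p = inj₁ (refl , refl)

SameEnds-sym : {p q : A × A} → SameEnds p q → SameEnds q p
SameEnds-sym (inj₁ (e₁ , e₂)) = inj₁ (sym e₁ , sym e₂)
SameEnds-sym (inj₂ (e₁ , e₂)) = inj₂ (sym e₂ , sym e₁)

SameEnds-trans : {p q r : A × A} → SameEnds p q → SameEnds q r → SameEnds p r
SameEnds-trans (inj₁ (e₁ , e₂)) (inj₁ (f₁ , f₂)) = inj₁ (trans e₁ f₁ , trans e₂ f₂)
SameEnds-trans (inj₁ (e₁ , e₂)) (inj₂ (f₁ , f₂)) = inj₂ (trans e₁ f₁ , trans e₂ f₂)
SameEnds-trans (inj₂ (e₁ , e₂)) (inj₁ (f₁ , f₂)) = inj₂ (trans e₁ f₂ , trans e₂ f₁)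
SameEnds-trans (inj₂ (e₁ , e₂)) (inj₂ (f₁ , f₂)) = inj₁ (trans e₁ f₂ , trans e₂ f₁)

SameEnds-map : {B : Set} (f : A → B) {p q : A × A} → SameEnds p q → SameEnds (mapPair f p) (mapPair f q)
SameEnds-map f (inj₁ (e₁ , e₂)) = inj₁ (cong f e₁ , cong f e₂)
SameEnds-map f (inj₂ (e₁ , e₂)) = inj₂ (cong f e₁ , cong f e₂)

SameEnds-≡ˡ : {p p′ q : A × A} → p ≡ p′ → SameEnds p′ q → SameEnds p q
SameEnds-≡ˡ refl s = s

SameEnds-≡ʳ : {p q q′ : A × A} → q ≡ q′ → SameEnds p q′ → SameEnds p q
SameEnds-≡ʳ refl s = s

Joins⇒SameEnds : ∀ (G : Graph) {i u w} → Joins G i u w → SameEnds (ends G i) (u , w)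
Joins⇒SameEnds G (inj₁ refl) = inj₁ (refl , refl)
Joins⇒SameEnds G (inj₂ refl) = inj₂ (refl , refl)

SameEnds⇒Joins : ∀ (G : Graph) {i u w} → SameEnds (ends G i) (u , w) → Joins G i u w
SameEnds⇒Joins G (inj₁ (e₁ , e₂)) = inj₁ (cong₂ _,_ e₁ e₂)
SameEnds⇒Joins G (inj₂ (e₁ , e₂)) = inj₂ (cong₂ _,_ e₁ e₂)

Joins-transport : ∀ (G H : Graph) (f : Fin (nV G) → Fin (nV H)) {i k u w} →
                  SameEnds (ends H k) (mapPair f (ends G i)) → Joins G i u w → Joins H k (f u) (f w)
Joins-transport G H f s j = SameEnds⇒Joins H (SameEnds-trans s (SameEnds-map f (Joins⇒SameEnds G j)))

-- Walks

module _ {G : Graph} {P : Fin (nV G) → Set} {R : Fin (nE G) → Set} where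

  source : ∀ {u v} → Walk G P R u v → P u
  source (here p)         = p
  source (step _ _ _ p _) = p

  infixr 5 _++ʷ_

  _++ʷ_ : ∀ {u v w} → Walk G P R u v → Walk G P R v w → Walk G P R u w
  here _         ++ʷ w′ = w′
  step i r j p w ++ʷ w′ = step i r j p (w ++ʷ w′)

  edgeʷ : ∀ {u w} i → R i → Joins G i u w → P u → P w → Walk G P R u w
  edgeʷ i r j pu pw = step i r j pu (here pw)

  reverseʷ : ∀ {u v} → Walk G P R u v → Walk G P R v u
  reverseʷ (here p)         = here p
  reverseʷ (step i r j p w) = reverseʷ w ++ʷ edgeʷ i r (Sum.swap j) (source w) p

weakenʷ : ∀ {G} {P P′ : Fin (nV G) → Set} {R R′ : Fin (nE G) → Set} →
          (∀ {x} → P x → P′ x) → (∀ {i} → R i → R′ i) →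
          ∀ {u v} → Walk G P R u v → Walk G P′ R′ u v
weakenʷ f g (here p)         = here (f p)
weakenʷ f g (step i r j p w) = step i (g r) j (f p) (weakenʷ f g w)

mapʷ : ∀ {G H} {P : Fin (nV G) → Set} {R : Fin (nE G) → Set}
       {P′ : Fin (nV H) → Set} {R′ : Fin (nE H) → Set} (φ : Fin (nV G) → Fin (nV H)) →
       (∀ {x} → P x → P′ (φ x)) →
       (∀ {u w} i → R i → Joins G i u w → P u → P w → Walk H P′ R′ (φ u) (φ w)) →
       ∀ {u v} → Walk G P R u v → Walk H P′ R′ (φ u) (φ v)
mapʷ φ fp fe (here p)         = here (fp p)
mapʷ φ fp fe (step i r j p w) = fe i r j p (source w) ++ʷ mapʷ φ fp fe w

module _ {n : ℕ} {P : Fin n → Set} (P? : Decidable P) where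

  private
    side : ∀ {B : Set} → Dec B → Side
    side d = if does d then inside else outside

  subsetOf : Subset n
  subsetOf = tabulate (side ∘ P?)

  ∈-subsetOf⁺ : ∀ {x} → P x → x ∈ₛ subsetOf
  ∈-subsetOf⁺ {x} px = lookup⇒[]= x subsetOf (trans (lookup∘tabulate _ x) (inside-if (P? x)))
    where
    inside-if : (d : Dec (P x)) → side d ≡ inside
    inside-if (yes _)  = refl
    inside-if (no ¬px) = ⊥-elim (¬px px)

  ∈-subsetOf⁻ : ∀ {x} → x ∈ₛ subsetOf → P x
  ∈-subsetOf⁻ {x} x∈ = holds (P? x) (trans (sym (lookup∘tabulate _ x)) ([]=⇒lookup x∈))
    where
    holds : (d : Dec (P x)) → side d ≡ inside → P x
    holds (yes px) _ = px

module _ {n : ℕ} where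

  oneOfTwoAvoiding : ∀ {P : Fin n → Set} {x y} → x ≢ y → P x → P y → ∀ p → ∃ λ w → P w × w ≢ p
  oneOfTwoAvoiding {x = x} {y} x≢y px py p with x ≟ p
  ... | no x≢p  = x , px , x≢p
  ... | yes refl = y , py , x≢y ∘ sym

  oneOfThreeAvoiding : ∀ {P : Fin n → Set} {x y z} → x ≢ y → x ≢ z → y ≢ z → P x → P y → P z →
                       ∀ p q → ∃ λ w → P w × w ≢ p × w ≢ q
  oneOfThreeAvoiding {P} {x} {y} {z} x≢y x≢z y≢z px py pz p q with x ≟ p | x ≟ q
  ... | no x≢p   | no x≢q   = x , px , x≢p , x≢q
  ... | yes refl | _        = avoid (x≢y ∘ sym) (x≢z ∘ sym)
    where
    avoid : y ≢ p → z ≢ p → ∃ λ w → P w × w ≢ p × w ≢ q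
    avoid y≢p z≢p with oneOfTwoAvoiding {P = λ w → P w × w ≢ p} y≢z (py , y≢p) (pz , z≢p) q
    ... | w , (pw , w≢p) , w≢q = w , pw , w≢p , w≢q
  ... | no _     | yes refl = avoid (x≢y ∘ sym) (x≢z ∘ sym)
    where
    avoid : y ≢ q → z ≢ q → ∃ λ w → P w × w ≢ p × w ≢ q
    avoid y≢q z≢q with oneOfTwoAvoiding {P = λ w → P w × w ≢ q} y≢z (py , y≢q) (pz , z≢q) p
    ... | w , (pw , w≢q) , w≢p = w , pw , w≢p , w≢q

∈-∪⁅⁆⁻ : ∀ {n} {p : Subset n} {x y} → x ∈ₛ p ∪ ⁅ y ⁆ → x ∈ₛ p ⊎ x ≡ y
∈-∪⁅⁆⁻ {p = p} {y = y} x∈ = Sum.map₂ (x∈⁅y⁆⇒x≡y y) (x∈p∪q⁻ p ⁅ y ⁆ x∈)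

∈-∪⁅⁆⁺ : ∀ {n} {p : Subset n} {x y} → x ∈ₛ p ⊎ x ≡ y → x ∈ₛ p ∪ ⁅ y ⁆
∈-∪⁅⁆⁺ (inj₁ x∈p)  = x∈p∪q⁺ (inj₁ x∈p)
∈-∪⁅⁆⁺ (inj₂ refl) = x∈p∪q⁺ (inj₂ (x∈⁅x⁆ _))

-- K₄ minors from branch sets

Adjacent : (G : Graph) → Fin (nV G) → Fin (nV G) → Set
Adjacent G x y = ∃ λ i → Joins G i x y

Adjacent-sym : ∀ {G x y} → Adjacent G x y → Adjacent G y x
Adjacent-sym (i , j) = i , Sum.swap j

data K4Edge : Fin 4 → Fin 4 → Set where
  0<1 : K4Edge zero (suc zero)
  0<2 : K4Edge zero (suc (suc zero))
  0<3 : K4Edge zero (suc (suc (suc zero)))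
  1<2 : K4Edge (suc zero) (suc (suc zero))
  1<3 : K4Edge (suc zero) (suc (suc (suc zero)))
  2<3 : K4Edge (suc (suc zero)) (suc (suc (suc zero)))

K4Edge-orient : ∀ i j → i ≢ j → K4Edge i j ⊎ K4Edge j i
K4Edge-orient zero                   zero                   i≢j = ⊥-elim (i≢j refl)
K4Edge-orient zero                   (suc zero)             _   = inj₁ 0<1
K4Edge-orient zero                   (suc (suc zero))       _   = inj₁ 0<2
K4Edge-orient zero                   (suc (suc (suc zero))) _   = inj₁ 0<3
K4Edge-orient (suc zero)             zero                   _   = inj₂ 0<1
K4Edge-orient (suc zero)             (suc zero)             i≢j = ⊥-elim (i≢j refl)
K4Edge-orient (suc zero)             (suc (suc zero))       _   = inj₁ 1<2
K4Edge-orient (suc zero)             (suc (suc (suc zero))) _   = inj₁ 1<3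
K4Edge-orient (suc (suc zero))       zero                   _   = inj₂ 0<2
K4Edge-orient (suc (suc zero))       (suc zero)             _   = inj₂ 1<2
K4Edge-orient (suc (suc zero))       (suc (suc zero))       i≢j = ⊥-elim (i≢j refl)
K4Edge-orient (suc (suc zero))       (suc (suc (suc zero))) _   = inj₁ 2<3
K4Edge-orient (suc (suc (suc zero))) zero                   _   = inj₂ 0<3
K4Edge-orient (suc (suc (suc zero))) (suc zero)             _   = inj₂ 1<3
K4Edge-orient (suc (suc (suc zero))) (suc (suc zero))       _   = inj₂ 2<3
K4Edge-orient (suc (suc (suc zero))) (suc (suc (suc zero))) i≢j = ⊥-elim (i≢j refl)

record BranchSets (G : Graph) : Set₁ where
  field
    Branch    : Fin 4 → Fin (nV G) → Set
    branch?   : ∀ i → Decidable (Branch i)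
    nonempty  : ∀ i → ∃ (Branch i)
    connected : ∀ i {x y} → Branch i x → Branch i y → Walk G (Branch i) (AllE G) x y
    disjoint  : ∀ {i j x} → K4Edge i j → Branch i x → Branch j x → ⊥
    adjacent  : ∀ {i j} → K4Edge i j → ∃₂ λ x y → Branch i x × Branch j y × Adjacent G x y

module _ {G : Graph} (B : BranchSets G) where
  open BranchSets B

  private
    branch : Fin (nV G) → Maybe (Fin 4)
    branch x with any? (λ i → branch? i x)
    ... | yes (i , _) = just i
    ... | no _        = nothing

    unique : ∀ {i j x} → Branch i x → Branch j x → i ≡ j
    unique {i} {j} bi bj with i ≟ j
    ... | yes i≡j = i≡j
    ... | no i≢j with K4Edge-orient i j i≢j
    ...   | inj₁ ij = ⊥-elim (disjoint ij bi bj)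
    ...   | inj₂ ji = ⊥-elim (disjoint ji bj bi)

    branch-sound : ∀ {i x} → branch x ≡ just i → Branch i x
    branch-sound {x = x} eq with any? (λ i → branch? i x)
    branch-sound refl | yes (_ , bi) = bi

    branch-complete : ∀ {i x} → Branch i x → branch x ≡ just i
    branch-complete {i} {x} bi with any? (λ i → branch? i x)
    ... | yes (j , bj) = cong just (unique bj bi)
    ... | no ¬found    = ⊥-elim (¬found (i , bi))

    adjacent≢ : ∀ i j → i ≢ j → ∃₂ λ x y → Branch i x × Branch j y × Adjacent G x y
    adjacent≢ i j i≢j with K4Edge-orient i j i≢j
    ... | inj₁ ij = adjacent ij
    ... | inj₂ ji with adjacent ji
    ...   | y , x , by , bx , y~x = x , y , bx , by , Adjacent-sym y~x

  branchSets⇒K4Model : K4Model G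
  branchSets⇒K4Model = record
    { branch    = branch
    ; nonempty  = λ i → proj₁ (nonempty i) , branch-complete (proj₂ (nonempty i))
    ; connected = λ i u v bu bv →
        weakenʷ branch-complete (λ _ → tt) (connected i (branch-sound bu) (branch-sound bv))
    ; adjacent  = λ i j i≢j → adjacentModel (adjacent≢ i j i≢j) }
    where
    adjacentModel : ∀ {i j} → (∃₂ λ x y → Branch i x × Branch j y × Adjacent G x y) →
                    Σ (Fin (nE G)) λ e → Σ (Fin (nV G)) λ u → Σ (Fin (nV G)) λ w →
                      Joins G e u w × branch u ≡ just i × branch w ≡ just j
    adjacentModel (x , y , bx , by , e , j) = e , x , y , j , branch-complete bx , branch-complete by

-- Paths and connected components

data Last (y : A) : List A → Set where
  end  : Last y (y ∷ [])
  skip : ∀ {x xs} → Last y xs → Last y (x ∷ xs)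

Last⇒∈ : ∀ {y : A} {xs} → Last y xs → y ∈ xs
Last⇒∈ end      = here refl
Last⇒∈ (skip l) = there (Last⇒∈ l)

Last-++⁻ʳ : ∀ (xs : List A) {y ys b} → Last b (xs ++ y ∷ ys) → Last b (y ∷ ys)
Last-++⁻ʳ []           l        = l
Last-++⁻ʳ (x ∷ [])     (skip l) = l
Last-++⁻ʳ (x ∷ x′ ∷ xs) (skip l) = Last-++⁻ʳ (x′ ∷ xs) l

Last-∷ʳ : ∀ (xs : List A) {y} → Last y (xs ++ y ∷ [])
Last-∷ʳ []       = end
Last-∷ʳ (x ∷ xs) = skip (Last-∷ʳ xs)

module _ {R : A → A → Set} where

  Linked-++⁻ˡ : ∀ xs {ys} → Linked R (xs ++ ys) → Linked R xs
  Linked-++⁻ˡ []            _           = []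
  Linked-++⁻ˡ (x ∷ [])      _           = [-]
  Linked-++⁻ˡ (x ∷ x′ ∷ xs) (r ∷ rs)    = r ∷ Linked-++⁻ˡ (x′ ∷ xs) rs

  Linked-++⁻ʳ : ∀ xs {ys} → Linked R (xs ++ ys) → Linked R ys
  Linked-++⁻ʳ []            rs       = rs
  Linked-++⁻ʳ (x ∷ xs)      rs       = Linked-++⁻ʳ xs (Linked.tail rs)

  Linked-∷ʳ : ∀ {xs l y} → Linked R xs → Last l xs → R l y → Linked R (xs ++ y ∷ [])
  Linked-∷ʳ [-]      end      r = r ∷ [-]
  Linked-∷ʳ (r ∷ rs) (skip l) r′ = r ∷ Linked-∷ʳ rs l r′

  Linked-predecessor : ∀ x xs {y ys} → Linked R (x ∷ xs ++ y ∷ ys) → ∃ λ l → l ∈ x ∷ xs × R l y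
  Linked-predecessor x []       (r ∷ _)  = x , here refl , r
  Linked-predecessor x (x′ ∷ xs) (_ ∷ rs) with Linked-predecessor x′ xs rs
  ... | l , l∈ , r = l , there l∈ , r

  Linked-before : ∀ {h t} xs {y ys} → Linked R (h ∷ t) → h ∷ t ≡ xs ++ y ∷ ys →
                  h ≡ y ⊎ ∃ λ l → l ∈ xs × R l y
  Linked-before []       _  refl = inj₁ refl
  Linked-before (x ∷ xs) rs refl = inj₂ (Linked-predecessor x xs rs)

  Linked-successor : ∀ {x xs y} → Linked R (x ∷ xs) → y ∈ xs → ∃ λ z → z ∈ xs × R x z
  Linked-successor (r ∷ _) _ = _ , here refl , r

∈-prefix⇒head∈ : ∀ {h t} (xs : List A) {ys x} → h ∷ t ≡ xs ++ ys → x ∈ xs → h ∈ xs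
∈-prefix⇒head∈ (x ∷ xs) refl _ = here refl

Last-∷⁻ : ∀ {b x xs} {y : A} → Last b (x ∷ xs) → y ∈ xs → b ∈ xs
Last-∷⁻ (skip l) _ = Last⇒∈ l

Unique-++⁻ʳ : ∀ (xs : List A) {ys} → Unique (xs ++ ys) → Unique ys
Unique-++⁻ʳ []       u        = u
Unique-++⁻ʳ (x ∷ xs) (_ ∷ u)  = Unique-++⁻ʳ xs u

Unique-++-disjoint : ∀ (xs : List A) {ys x} → Unique (xs ++ ys) → x ∈ xs → x ∉ ys
Unique-++-disjoint (x ∷ xs) (px ∷ _) (here refl) x∈ys = All.lookup (All-++⁻ʳ xs px) x∈ys refl
Unique-++-disjoint (x ∷ xs) (_ ∷ u)  (there x∈xs) = Unique-++-disjoint xs u x∈xs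

module _ {Q : A → Set} (Q? : Decidable Q) where

  firstOccurrence : ∀ xs → All (¬_ ∘ Q) xs ⊎ ∃₂ λ ys c → ∃ λ zs → xs ≡ ys ++ c ∷ zs × All (¬_ ∘ Q) ys × Q c
  firstOccurrence xs with first (Sum.swap ∘ Dec.toSum ∘ Q?) xs
  ... | inj₂ ¬xs = inj₁ ¬xs
  ... | inj₁ f with toView f
  ...   | First._++_∷_ ¬ys qc zs = inj₂ (_ , _ , zs , refl , ¬ys , qc)

data Occurrences (Q : A → Set) (xs : List A) : Set where
  none : All (¬_ ∘ Q) xs → Occurrences Q xs
  one  : ∀ ys c zs → xs ≡ ys ++ c ∷ zs → All (¬_ ∘ Q) ys → Q c → All (¬_ ∘ Q) zs → Occurrences Q xs
  two  : ∀ ys c zs d ws → xs ≡ ys ++ c ∷ zs ++ d ∷ ws →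
         All (¬_ ∘ Q) ys → Q c → All (¬_ ∘ Q) zs → Q d → All (¬_ ∘ Q) ws → Occurrences Q xs
  many : ∀ ys d zs {c e} → xs ≡ ys ++ d ∷ zs → c ∈ ys → Q c → Q d → e ∈ zs → Q e → Occurrences Q xs

occurrences : {Q : A → Set} → Decidable Q → ∀ xs → Occurrences Q xs
occurrences Q? xs with firstOccurrence Q? xs
... | inj₁ ¬xs = none ¬xs
... | inj₂ (ys , c , zs , refl , ¬ys , qc) with firstOccurrence Q? zs
...   | inj₁ ¬zs = one ys c zs refl ¬ys qc ¬zs
...   | inj₂ (zs′ , d , ws , refl , ¬zs′ , qd) with firstOccurrence Q? ws
...     | inj₁ ¬ws = two ys c zs′ d ws refl ¬ys qc ¬zs′ qd ¬ws
...     | inj₂ (ws′ , e , vs , refl , _ , qe) =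
          many (ys ++ c ∷ zs′) d (ws′ ++ e ∷ vs) (sym (++-assoc ys (c ∷ zs′) (d ∷ ws′ ++ e ∷ vs)))
               (∈-++⁺ʳ ys (here refl)) qc qd (∈-++⁺ʳ ws′ (here refl)) qe

module Paths (G : Graph) where

  V : Set
  V = Fin (nV G)

  infix 4 _~_
  _~_ : V → V → Set
  _~_ = Adjacent G

  _~?_ : ∀ x y → Dec (x ~ y)
  x ~? y = any? (λ i → ≡-dec _≟_ _≟_ (ends G i) (x , y) ⊎-dec ≡-dec _≟_ _≟_ (ends G i) (y , x))

  WalkIn : (V → Set) → V → V → Set
  WalkIn X = Walk G X (AllE G)

  Linked⇒WalkIn : ∀ {X : V → Set} {x xs y} → Linked _~_ (x ∷ xs) → All X (x ∷ xs) → y ∈ x ∷ xs → WalkIn X x y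
  Linked⇒WalkIn _              (px ∷ _)   (here refl) = here px
  Linked⇒WalkIn ((i , j) ∷ rs) (px ∷ pxs) (there y∈)  = step i tt j px (Linked⇒WalkIn rs pxs y∈)

  Linked⇒WalkIn′ : ∀ {X : V → Set} {xs x y} → Linked _~_ xs → All X xs → x ∈ xs → y ∈ xs → WalkIn X x y
  Linked⇒WalkIn′ {xs = _ ∷ _} rs pxs x∈ y∈ = reverseʷ (Linked⇒WalkIn rs pxs x∈) ++ʷ Linked⇒WalkIn rs pxs y∈

  record PathIn (X : V → Set) (x r : V) : Set where
    field
      rest   : List V
      linked : Linked _~_ (x ∷ rest)
      unique : Unique (x ∷ rest)
      within : All X (x ∷ rest)
      last   : Last r (x ∷ rest)

  PathIn⇒WalkIn : ∀ {X x r} → PathIn X x r → WalkIn X x r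
  PathIn⇒WalkIn p = Linked⇒WalkIn linked within (Last⇒∈ last)
    where open PathIn p

  record Component (T : Subset (nV G)) (r : V) : Set where
    field
      C         : Subset (nV G)
      C⊆T       : C ⊆ T
      r∈C       : r ∈ₛ C
      pathTo    : ∀ {x} → x ∈ₛ C → PathIn (_∈ₛ C) x r
      closed    : ∀ {x y} → x ∈ₛ C → y ∈ₛ T → x ~ y → y ∈ₛ C

  component : ∀ {T r} → r ∈ₛ T → Component T r
  component {T} {r} r∈T = grow ⁅ r ⁆ singleton⊆T (x∈⁅x⁆ r) trivialPath (⊃-wellFounded _)
    where
    singleton⊆T : ⁅ r ⁆ ⊆ T
    singleton⊆T x∈ = subst (_∈ₛ T) (sym (x∈⁅y⁆⇒x≡y r x∈)) r∈T

    trivialPath : ∀ {x} → x ∈ₛ ⁅ r ⁆ → PathIn (_∈ₛ ⁅ r ⁆) x r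
    trivialPath x∈ with x∈⁅y⁆⇒x≡y r x∈
    ... | refl = record { rest = [] ; linked = [-] ; unique = [] ∷ [] ; within = x∈ ∷ [] ; last = end }

    Exit : Subset (nV G) → Set
    Exit C = ∃₂ λ x y → x ∈ₛ C × y ∈ₛ T × y ∉ₛ C × x ~ y

    exit? : ∀ C → Dec (Exit C)
    exit? C = any? λ x → any? λ y → x ∈? C ×-dec y ∈? T ×-dec ¬? (y ∈? C) ×-dec x ~? y

    grow : ∀ C → C ⊆ T → r ∈ₛ C → (∀ {x} → x ∈ₛ C → PathIn (_∈ₛ C) x r) → Acc _⊃_ C → Component T r
    grow C C⊆T r∈C pathTo (acc larger) with exit? C
    ... | no noExit = record { C = C ; C⊆T = C⊆T ; r∈C = r∈C ; pathTo = pathTo ; closed = closed }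
      where
      closed : ∀ {x y} → x ∈ₛ C → y ∈ₛ T → x ~ y → y ∈ₛ C
      closed {x} {y} x∈C y∈T x~y with y ∈? C
      ... | yes y∈C = y∈C
      ... | no y∉C  = ⊥-elim (noExit (x , y , x∈C , y∈T , y∉C , x~y))
    ... | yes (x , y , x∈C , y∈T , y∉C , x~y) =
      grow C′ C′⊆T (old r∈C) pathTo′ (larger (old , y , new , y∉C))
      where
      C′ : Subset (nV G)
      C′ = C ∪ ⁅ y ⁆
      old : C ⊆ C′
      old = x∈p∪q⁺ ∘ inj₁
      new : y ∈ₛ C′
      new = x∈p∪q⁺ (inj₂ (x∈⁅x⁆ y))
      C′⊆T : C′ ⊆ T
      C′⊆T z∈ with x∈p∪q⁻ C ⁅ y ⁆ z∈
      ... | inj₁ z∈C = C⊆T z∈C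
      ... | inj₂ z∈y = subst (_∈ₛ T) (sym (x∈⁅y⁆⇒x≡y y z∈y)) y∈T
      widen : ∀ {z} → PathIn (_∈ₛ C) z r → PathIn (_∈ₛ C′) z r
      widen p = record { PathIn p ; within = All.map old (PathIn.within p) }
      pathTo′ : ∀ {z} → z ∈ₛ C′ → PathIn (_∈ₛ C′) z r
      pathTo′ z∈ with x∈p∪q⁻ C ⁅ y ⁆ z∈
      ... | inj₁ z∈C = widen (pathTo z∈C)
      ... | inj₂ z∈y with x∈⁅y⁆⇒x≡y y z∈y
      ... | refl = record
        { rest   = x ∷ rest
        ; linked = Adjacent-sym x~y ∷ linked
        ; unique = ¬Any⇒All¬ _ (λ y∈ → y∉C (All.lookup within y∈)) ∷ unique
        ; within = new ∷ All.map old within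
        ; last   = skip last }
        where open PathIn (pathTo x∈C)

-- K₄ minors in graphs of minimum degree three

module DegreeThree (G : Graph) where
  open Paths G
  open import Data.List.Membership.DecPropositional (_≟_ {nV G}) using () renaming (_∈?_ to _∈ₗ?_)

  record ThreeNeighbours (w : V) : Set where
    field
      n₁ n₂ n₃          : V
      w~n₁              : w ~ n₁
      w~n₂              : w ~ n₂
      w~n₃              : w ~ n₃
      n₁≢w              : n₁ ≢ w
      n₂≢w              : n₂ ≢ w
      n₃≢w              : n₃ ≢ w
      n₁≢n₂             : n₁ ≢ n₂
      n₁≢n₃             : n₁ ≢ n₃
      n₂≢n₃             : n₂ ≢ n₃

    neighbourAvoiding : ∀ p q → ∃ λ x → (w ~ x × x ≢ w) × x ≢ p × x ≢ q
    neighbourAvoiding = oneOfThreeAvoiding n₁≢n₂ n₁≢n₃ n₂≢n₃ (w~n₁ , n₁≢w) (w~n₂ , n₂≢w) (w~n₃ , n₃≢w)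

  Interior : Subset (nV G) → V → V → V → Set
  Interior S a b w = w ∈ₛ S × w ≢ a × w ≢ b

  -- S is attached to the rest of G only at a and b, and Outer, a connected set meeting S at
  -- most in b and adjacent to a, plays the rôle of an a–b path outside S
  record Piece : Set where
    field
      S           : Subset (nV G)
      a b         : V
      a∈S         : a ∈ₛ S
      b∈S         : b ∈ₛ S
      a≢b         : a ≢ b
      Outer       : Subset (nV G)
      outer∩S     : ∀ {x} → x ∈ₛ Outer → x ∈ₛ S → x ≡ b
      outerWalk   : ∀ {x} → x ∈ₛ Outer → WalkIn (_∈ₛ Outer) b x
      outer~a     : ∃ λ y → y ∈ₛ Outer × y ~ a
      degree      : ∀ {w} → Interior S a b w → ThreeNeighbours w
      closed      : ∀ {w x} → Interior S a b w → w ~ x → x ∈ₛ S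
      hasInterior : ∃ (Interior S a b)

  module InductionStep (π : Piece) (recurse : ∀ (π′ : Piece) → Piece.S π′ ⊂ Piece.S π → K4Model G) where
    open Piece π

    Interior? : ∀ x → Dec (Interior S a b x)
    Interior? x = x ∈? S ×-dec ¬? (x ≟ a) ×-dec ¬? (x ≟ b)

    -- a part L of S hanging from the single vertex r is a smaller piece
    pendant : (L : Subset (nV G)) → (∀ {x} → x ∈ₛ L → Interior S a b x) →
              ∀ {r z o} → r ∈ₛ S → z ∈ₛ L → z ~ r → z ≢ r →
              (∀ {w x} → w ∈ₛ L → w ~ x → x ∈ₛ L ⊎ x ≡ r) →
              o ∈ₛ S → o ∉ₛ L → o ≢ r → K4Model G
    pendant L L-interior {r} {z} {o} r∈S z∈L z~r z≢r leaves o∈S o∉L o≢r =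
      recurse π′ (S′⊆S , o , o∈S , Sum.[ o∉L , o≢r ] ∘ ∈-∪⁅⁆⁻)
      where
      S′ : Subset (nV G)
      S′ = L ∪ ⁅ r ⁆
      inL : ∀ {w} → Interior S′ r z w → w ∈ₛ L
      inL (w∈S′ , w≢r , _) = Sum.[ (λ w∈L → w∈L) , ⊥-elim ∘ w≢r ] (∈-∪⁅⁆⁻ w∈S′)
      closed′ : ∀ {w x} → w ∈ₛ L → w ~ x → x ∈ₛ S′
      closed′ w∈L w~x = ∈-∪⁅⁆⁺ (leaves w∈L w~x)
      interior′ : ∃ (Interior S′ r z)
      interior′ with ThreeNeighbours.neighbourAvoiding (degree (L-interior z∈L)) r z
      ... | x , (z~x , _) , x≢r , x≢z = x , closed′ z∈L z~x , x≢r , x≢z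
      π′ : Piece
      π′ = record
        { S = S′ ; a = r ; b = z
        ; a∈S = ∈-∪⁅⁆⁺ (inj₂ refl) ; b∈S = ∈-∪⁅⁆⁺ (inj₁ z∈L) ; a≢b = z≢r ∘ sym
        ; Outer = ⁅ z ⁆
        ; outer∩S = λ x∈ _ → x∈⁅y⁆⇒x≡y z x∈
        ; outerWalk = λ x∈ → subst (WalkIn (_∈ₛ ⁅ z ⁆) z) (sym (x∈⁅y⁆⇒x≡y z x∈)) (here (x∈⁅x⁆ z))
        ; outer~a = z , x∈⁅x⁆ z , z~r
        ; degree = λ w∈ → degree (L-interior (inL w∈))
        ; closed = λ w∈ → closed′ (inL w∈)
        ; hasInterior = interior′ }
      S′⊆S : S′ ⊆ S
      S′⊆S x∈ = Sum.[ proj₁ ∘ L-interior , (λ { refl → r∈S }) ] (∈-∪⁅⁆⁻ x∈)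

    record Spine : Set where
      constructor spine
      field
        p₁     : V
        rest   : List V
        linked : Linked _~_ (a ∷ p₁ ∷ rest)
        unique : Unique (a ∷ p₁ ∷ rest)
        inS    : All (_∈ₛ S) (a ∷ p₁ ∷ rest)
        last   : Last b rest

      vertices : List V
      vertices = a ∷ p₁ ∷ rest

    module Bridge (σ : Spine) {y} (y∈S : y ∈ₛ S) (y∉σ : y ∉ Spine.vertices σ) where
      open Spine σ

      off? : ∀ x → Dec (x ∈ₛ S × x ∉ vertices)
      off? x = x ∈? S ×-dec ¬? (x ∈ₗ? vertices)

      open Component (component {subsetOf off?} (∈-subsetOf⁺ off? (y∈S , y∉σ))) renaming (closed to C-closed)

      a∈σ : a ∈ vertices
      a∈σ = here refl
      p₁∈σ : p₁ ∈ vertices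
      p₁∈σ = there (here refl)
      b∈σ : b ∈ vertices
      b∈σ = there (there (Last⇒∈ last))

      σ⊆S : ∀ {x} → x ∈ vertices → x ∈ₛ S
      σ⊆S = All.lookup inS

      a≢p₁ : a ≢ p₁
      a≢p₁ = All.head (Unique.head unique)
      p₁≢b : p₁ ≢ b
      p₁≢b = All.lookup (Unique.head (Unique.tail unique)) (Last⇒∈ last)

      off : ∀ {x} → x ∈ₛ C → x ∈ₛ S × x ∉ vertices
      off x∈C = ∈-subsetOf⁻ off? (C⊆T x∈C)

      C∉σ : ∀ {x} → x ∈ₛ C → x ∉ vertices
      C∉σ = proj₂ ∘ off

      C-interior : ∀ {x} → x ∈ₛ C → Interior S a b x
      C-interior x∈C = proj₁ (off x∈C) , (λ { refl → C∉σ x∈C a∈σ }) , (λ { refl → C∉σ x∈C b∈σ })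

      C∩Outer : ∀ {x} → x ∈ₛ C → x ∉ₛ Outer
      C∩Outer x∈C x∈O with outer∩S x∈O (proj₁ (off x∈C))
      ... | refl = C∉σ x∈C b∈σ

      Attached : V → Set
      Attached x = ∃ λ w → w ∈ₛ C × w ~ x

      attached? : ∀ x → Dec (Attached x)
      attached? x = any? λ w → w ∈? C ×-dec w ~? x

      leaves : ∀ {w x} → w ∈ₛ C → w ~ x → (x ∈ vertices × Attached x) ⊎ x ∈ₛ C
      leaves {w} {x} w∈C w~x with x ∈ₗ? vertices
      ... | yes x∈σ = inj₁ (x∈σ , w , w∈C , w~x)
      ... | no x∉σ  = inj₂ (C-closed w∈C (∈-subsetOf⁺ off? (closed (C-interior w∈C) w~x , x∉σ)) w~x)

      stays : ∀ {w x} → All (¬_ ∘ Attached) vertices → w ∈ₛ C → w ~ x → x ∈ₛ C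
      stays ¬att w∈C w~x = Sum.[ (λ (x∈σ , att) → ⊥-elim (All.lookup ¬att x∈σ att)) , (λ x∈C → x∈C) ] (leaves w∈C w~x)

      noAttachment : All (¬_ ∘ Attached) vertices → K4Model G
      noAttachment ¬att =
        pendant C C-interior y∈S n₁∈C (Adjacent-sym w~n₁) n₁≢w (λ w∈C w~x → inj₁ (stays ¬att w∈C w~x))
                (σ⊆S a∈σ) (λ a∈C → C∉σ a∈C a∈σ) (λ { refl → y∉σ a∈σ })
        where
        open ThreeNeighbours (degree (C-interior r∈C))
        n₁∈C : n₁ ∈ₛ C
        n₁∈C = stays ¬att r∈C w~n₁

      oneAttachment : ∀ A c R → vertices ≡ A ++ c ∷ R →
                      All (¬_ ∘ Attached) A → Attached c → All (¬_ ∘ Attached) R → K4Model G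
      oneAttachment A c R eq ¬A (z , z∈C , z~c) ¬R with oneOfTwoAvoiding a≢p₁ a∈σ p₁∈σ c
      ... | o , o∈σ , o≢c =
        pendant C C-interior (σ⊆S c∈σ) z∈C z~c (λ { refl → C∉σ z∈C c∈σ }) internal
                (σ⊆S o∈σ) (λ o∈C → C∉σ o∈C o∈σ) o≢c
        where
        c∈σ : c ∈ vertices
        c∈σ = subst (c ∈_) (sym eq) (∈-++⁺ʳ A (here refl))
        internal : ∀ {w x} → w ∈ₛ C → w ~ x → x ∈ₛ C ⊎ x ≡ c
        internal w∈C w~x with leaves w∈C w~x
        ... | inj₂ x∈C = inj₁ x∈C
        ... | inj₁ (x∈σ , att) with ∈-++⁻ A (subst (_ ∈_) eq x∈σ)
        ...   | inj₁ x∈A        = ⊥-elim (All.lookup ¬A x∈A att)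
        ...   | inj₂ (here x≡c) = inj₂ x≡c
        ...   | inj₂ (there x∈R) = ⊥-elim (All.lookup ¬R x∈R att)

      -- the bridge together with its two attachments c and d is a smaller piece, the rest of the
      -- spine joining the old Outer to the new one
      module TwoAttachments (A₀ : List V) (c : V) (B₀ : List V) (d : V) (R : List V)
                            (eq : vertices ≡ A₀ ++ c ∷ B₀ ++ d ∷ R)
                            (¬A₀ : All (¬_ ∘ Attached) A₀) (¬B₀ : All (¬_ ∘ Attached) B₀)
                            (¬R : All (¬_ ∘ Attached) R) where
        D : List V
        D = d ∷ R

        toσ : ∀ {x} → x ∈ A₀ ++ c ∷ B₀ ++ D → x ∈ vertices
        toσ = subst (_ ∈_) (sym eq)

        linked′ : Linked _~_ (A₀ ++ c ∷ B₀ ++ D)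
        linked′ = subst (Linked _~_) eq linked

        unique′ : Unique (A₀ ++ c ∷ B₀ ++ D)
        unique′ = subst Unique eq unique

        linkedD : Linked _~_ D
        linkedD = Linked-++⁻ʳ (c ∷ B₀) (Linked-++⁻ʳ A₀ linked′)

        b∈D : b ∈ D
        b∈D = Last⇒∈ (Last-++⁻ʳ (c ∷ B₀) (Last-++⁻ʳ A₀ (subst (Last b) eq (skip (skip last)))))

        c∈σ : c ∈ vertices
        c∈σ = toσ (∈-++⁺ʳ A₀ (here refl))

        d∈σ : d ∈ vertices
        d∈σ = toσ (∈-++⁺ʳ A₀ (there (∈-++⁺ʳ B₀ (here refl))))

        c∉A₀ : c ∉ A₀
        c∉A₀ c∈ = Unique-++-disjoint A₀ unique′ c∈ (here refl)

        c∉D : c ∉ D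
        c∉D c∈ = Unique[x∷xs]⇒x∉xs (Unique-++⁻ʳ A₀ unique′) (∈-++⁺ʳ B₀ c∈)

        S′ : Subset (nV G)
        S′ = (C ∪ ⁅ c ⁆) ∪ ⁅ d ⁆

        S′-cases : ∀ {x} → x ∈ₛ S′ → (x ∈ₛ C ⊎ x ≡ c) ⊎ x ≡ d
        S′-cases = Sum.map₁ ∈-∪⁅⁆⁻ ∘ ∈-∪⁅⁆⁻

        outer? : ∀ x → Dec (x ∈ A₀ ++ D)
        outer? x = x ∈ₗ? A₀ ++ D

        Outer′ : Subset (nV G)
        Outer′ = subsetOf outer? ∪ Outer

        Outer′-cases : ∀ {x} → x ∈ₛ Outer′ → x ∈ A₀ ⊎ x ∈ D ⊎ x ∈ₛ Outer
        Outer′-cases x∈ with x∈p∪q⁻ (subsetOf outer?) Outer x∈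
        ... | inj₁ x∈A₀D = Sum.map₂ inj₁ (∈-++⁻ A₀ (∈-subsetOf⁻ outer? x∈A₀D))
        ... | inj₂ x∈O   = inj₂ (inj₂ x∈O)

        A₀⊆Outer′ : ∀ {x} → x ∈ A₀ → x ∈ₛ Outer′
        A₀⊆Outer′ = x∈p∪q⁺ ∘ inj₁ ∘ ∈-subsetOf⁺ outer? ∘ ∈-++⁺ˡ

        D⊆Outer′ : ∀ {x} → x ∈ D → x ∈ₛ Outer′
        D⊆Outer′ = x∈p∪q⁺ ∘ inj₁ ∘ ∈-subsetOf⁺ outer? ∘ ∈-++⁺ʳ A₀

        Outer⊆Outer′ : ∀ {x} → x ∈ₛ Outer → x ∈ₛ Outer′
        Outer⊆Outer′ = x∈p∪q⁺ ∘ inj₂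

        Outer∩S⊆D : ∀ {x} → x ∈ₛ Outer → x ∈ₛ S → x ∈ D
        Outer∩S⊆D x∈O x∈S = subst (_∈ D) (sym (outer∩S x∈O x∈S)) b∈D

        outer∩S′ : ∀ {x} → x ∈ₛ Outer′ → x ∈ₛ S′ → x ≡ d
        outer∩S′ x∈O′ x∈S′ with S′-cases x∈S′
        ... | inj₂ x≡d         = x≡d
        ... | inj₁ (inj₁ x∈C)  = ⊥-elim (Sum.[ C∉σ x∈C ∘ toσ ∘ ∈-++⁺ˡ
                                          , Sum.[ C∉σ x∈C ∘ toσ ∘ ∈-++⁺ʳ A₀ ∘ there ∘ ∈-++⁺ʳ B₀
                                                , C∩Outer x∈C ] ] (Outer′-cases x∈O′))
        ... | inj₁ (inj₂ refl) = ⊥-elim (Sum.[ c∉A₀ , Sum.[ c∉D , (λ c∈O → c∉D (Outer∩S⊆D c∈O (σ⊆S c∈σ))) ] ]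
                                               (Outer′-cases x∈O′))

        y₀ : V
        y₀ = proj₁ outer~a

        y₀∈Outer : y₀ ∈ₛ Outer
        y₀∈Outer = proj₁ (proj₂ outer~a)

        walkD : ∀ {x} → x ∈ D → WalkIn (_∈ₛ Outer′) d x
        walkD = Linked⇒WalkIn linkedD (All.tabulate D⊆Outer′)

        walkOuter : ∀ {x} → x ∈ₛ Outer → WalkIn (_∈ₛ Outer′) d x
        walkOuter x∈O = walkD b∈D ++ʷ weakenʷ Outer⊆Outer′ (λ _ → tt) (outerWalk x∈O)

        walkA₀ : ∀ {x} → x ∈ A₀ → WalkIn (_∈ₛ Outer′) d x
        walkA₀ x∈A₀ = walkOuter y₀∈Outer
                   ++ʷ edgeʷ _ tt (proj₂ (proj₂ (proj₂ outer~a))) (Outer⊆Outer′ y₀∈Outer) (A₀⊆Outer′ a∈A₀)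
                   ++ʷ Linked⇒WalkIn′ (Linked-++⁻ˡ A₀ linked′) (All.tabulate A₀⊆Outer′) a∈A₀ x∈A₀
          where
          a∈A₀ : a ∈ A₀
          a∈A₀ = ∈-prefix⇒head∈ A₀ eq x∈A₀

        outer~c : ∃ λ x → x ∈ₛ Outer′ × x ~ c
        outer~c with Linked-before A₀ linked eq
        ... | inj₁ refl               = y₀ , Outer⊆Outer′ y₀∈Outer , proj₂ (proj₂ outer~a)
        ... | inj₂ (l , l∈A₀ , l~c) = l , A₀⊆Outer′ l∈A₀ , l~c

        inC : ∀ {w} → Interior S′ c d w → w ∈ₛ C
        inC (w∈S′ , w≢c , w≢d) = Sum.[ Sum.[ (λ w∈C → w∈C) , ⊥-elim ∘ w≢c ] , ⊥-elim ∘ w≢d ] (S′-cases w∈S′)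

        closed′ : ∀ {w x} → Interior S′ c d w → w ~ x → x ∈ₛ S′
        closed′ w∈ w~x with leaves (inC w∈) w~x
        ... | inj₂ x∈C = ∈-∪⁅⁆⁺ (inj₁ (∈-∪⁅⁆⁺ (inj₁ x∈C)))
        ... | inj₁ (x∈σ , att) with ∈-++⁻ A₀ (subst (_ ∈_) eq x∈σ)
        ...   | inj₁ x∈A₀ = ⊥-elim (All.lookup ¬A₀ x∈A₀ att)
        ...   | inj₂ (here refl) = ∈-∪⁅⁆⁺ (inj₁ (∈-∪⁅⁆⁺ (inj₂ refl)))
        ...   | inj₂ (there x∈B₀D) with ∈-++⁻ B₀ x∈B₀D
        ...     | inj₁ x∈B₀ = ⊥-elim (All.lookup ¬B₀ x∈B₀ att)
        ...     | inj₂ (here refl) = ∈-∪⁅⁆⁺ (inj₂ refl)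
        ...     | inj₂ (there x∈R) = ⊥-elim (All.lookup ¬R x∈R att)

        π′ : Piece
        π′ = record
          { S = S′ ; a = c ; b = d
          ; a∈S = ∈-∪⁅⁆⁺ (inj₁ (∈-∪⁅⁆⁺ (inj₂ refl))) ; b∈S = ∈-∪⁅⁆⁺ (inj₂ refl)
          ; a≢b = c∉D ∘ here
          ; Outer = Outer′
          ; outer∩S = outer∩S′
          ; outerWalk = λ x∈ → Sum.[ walkA₀ , Sum.[ walkD , walkOuter ] ] (Outer′-cases x∈)
          ; outer~a = outer~c
          ; degree = λ w∈ → degree (C-interior (inC w∈))
          ; closed = closed′
          ; hasInterior = y , ∈-∪⁅⁆⁺ (inj₁ (∈-∪⁅⁆⁺ (inj₁ r∈C))) ,
                          (λ { refl → y∉σ c∈σ }) , (λ { refl → y∉σ d∈σ }) }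

        S′⊆S : S′ ⊆ S
        S′⊆S x∈ = Sum.[ Sum.[ proj₁ ∘ off , (λ { refl → σ⊆S c∈σ }) ] , (λ { refl → σ⊆S d∈σ }) ] (S′-cases x∈)

        k4Model : K4Model G
        k4Model with oneOfThreeAvoiding a≢p₁ a≢b p₁≢b a∈σ p₁∈σ b∈σ c d
        ... | o , o∈σ , o≢c , o≢d =
          recurse π′ (S′⊆S , o , σ⊆S o∈σ , Sum.[ Sum.[ (λ o∈C → C∉σ o∈C o∈σ) , o≢c ] , o≢d ] ∘ S′-cases)

      -- with three attachments q, d, q′ in this order, the bridge, the spine before d, d itself and
      -- the spine after d together with Outer are the branch sets of a K₄ minor
      module ManyAttachments (A₁ : List V) (d : V) (R : List V) (eq : vertices ≡ A₁ ++ d ∷ R)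
                             {q q′ : V} (q∈A₁ : q ∈ A₁) (att-q : Attached q) (att-d : Attached d)
                             (q′∈R : q′ ∈ R) (att-q′ : Attached q′) where
        toσ : ∀ {x} → x ∈ A₁ ++ d ∷ R → x ∈ vertices
        toσ = subst (_ ∈_) (sym eq)

        linked′ : Linked _~_ (A₁ ++ d ∷ R)
        linked′ = subst (Linked _~_) eq linked

        unique′ : Unique (A₁ ++ d ∷ R)
        unique′ = subst Unique eq unique

        d∉A₁ : d ∉ A₁
        d∉A₁ d∈ = Unique-++-disjoint A₁ unique′ d∈ (here refl)

        A₁∩R : ∀ {x} → x ∈ A₁ → x ∉ R
        A₁∩R x∈ = Unique-++-disjoint A₁ unique′ x∈ ∘ there

        d∉R : d ∉ R
        d∉R = Unique[x∷xs]⇒x∉xs (Unique-++⁻ʳ A₁ unique′)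

        b∈R : b ∈ R
        b∈R = Last-∷⁻ (Last-++⁻ʳ A₁ (subst (Last b) eq (skip (skip last)))) q′∈R

        a∈A₁ : a ∈ A₁
        a∈A₁ = ∈-prefix⇒head∈ A₁ eq q∈A₁

        Outer∩S⊆R : ∀ {x} → x ∈ₛ Outer → x ∈ₛ S → x ∈ R
        Outer∩S⊆R x∈O x∈S = subst (_∈ R) (sym (outer∩S x∈O x∈S)) b∈R

        Branch : Fin 4 → V → Set
        Branch zero                   x = x ∈ₛ C
        Branch (suc zero)             x = x ∈ A₁
        Branch (suc (suc zero))       x = x ≡ d
        Branch (suc (suc (suc zero))) x = x ∈ R ⊎ x ∈ₛ Outer

        branch? : ∀ i x → Dec (Branch i x)
        branch? zero                   x = x ∈? C
        branch? (suc zero)             x = x ∈ₗ? A₁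
        branch? (suc (suc zero))       x = x ≟ d
        branch? (suc (suc (suc zero))) x = x ∈ₗ? R ⊎-dec x ∈? Outer

        nonempty : ∀ i → ∃ (Branch i)
        nonempty zero                   = y , r∈C
        nonempty (suc zero)             = a , a∈A₁
        nonempty (suc (suc zero))       = d , refl
        nonempty (suc (suc (suc zero))) = b , inj₁ b∈R

        toRoot : ∀ {x} → x ∈ₛ C → WalkIn (_∈ₛ C) x y
        toRoot = PathIn⇒WalkIn ∘ pathTo

        toB : ∀ {x} → Branch (suc (suc (suc zero))) x → WalkIn (Branch (suc (suc (suc zero)))) x b
        toB (inj₁ x∈R) = Linked⇒WalkIn′ (Linked.tail (Linked-++⁻ʳ A₁ linked′)) (All.tabulate inj₁) x∈R b∈R
        toB (inj₂ x∈O) = reverseʷ (weakenʷ inj₂ (λ _ → tt) (outerWalk x∈O))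

        connected : ∀ i {x x′} → Branch i x → Branch i x′ → WalkIn (Branch i) x x′
        connected zero                   x∈ x′∈ = toRoot x∈ ++ʷ reverseʷ (toRoot x′∈)
        connected (suc zero)             x∈ x′∈ =
          Linked⇒WalkIn′ (Linked-++⁻ˡ A₁ linked′) (All.tabulate (λ x∈ → x∈)) x∈ x′∈
        connected (suc (suc zero))       refl refl = here refl
        connected (suc (suc (suc zero))) x∈ x′∈ = toB x∈ ++ʷ reverseʷ (toB x′∈)

        disjoint : ∀ {i j x} → K4Edge i j → Branch i x → Branch j x → ⊥
        disjoint 0<1 x∈C x∈A₁        = C∉σ x∈C (toσ (∈-++⁺ˡ x∈A₁))
        disjoint 0<2 x∈C refl        = C∉σ x∈C (toσ (∈-++⁺ʳ A₁ (here refl)))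
        disjoint 0<3 x∈C (inj₁ x∈R)  = C∉σ x∈C (toσ (∈-++⁺ʳ A₁ (there x∈R)))
        disjoint 0<3 x∈C (inj₂ x∈O)  = C∩Outer x∈C x∈O
        disjoint 1<2 x∈A₁ refl       = d∉A₁ x∈A₁
        disjoint 1<3 x∈A₁ (inj₁ x∈R) = A₁∩R x∈A₁ x∈R
        disjoint 1<3 x∈A₁ (inj₂ x∈O) = A₁∩R x∈A₁ (Outer∩S⊆R x∈O (σ⊆S (toσ (∈-++⁺ˡ x∈A₁))))
        disjoint 2<3 refl (inj₁ d∈R) = d∉R d∈R
        disjoint 2<3 refl (inj₂ d∈O) = d∉R (Outer∩S⊆R d∈O (σ⊆S (toσ (∈-++⁺ʳ A₁ (here refl)))))

        adjacent : ∀ {i j} → K4Edge i j → ∃₂ λ x x′ → Branch i x × Branch j x′ × x ~ x′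
        adjacent 0<1 = let (w , w∈C , w~q) = att-q in w , q , w∈C , q∈A₁ , w~q
        adjacent 0<2 = let (w , w∈C , w~d) = att-d in w , d , w∈C , refl , w~d
        adjacent 0<3 = let (w , w∈C , w~q′) = att-q′ in w , q′ , w∈C , inj₁ q′∈R , w~q′
        adjacent 1<2 with Linked-before A₁ linked eq
        ... | inj₁ refl               = ⊥-elim (d∉A₁ a∈A₁)
        ... | inj₂ (l , l∈A₁ , l~d) = l , d , l∈A₁ , refl , l~d
        adjacent 1<3 = let (y₀ , y₀∈O , y₀~a) = outer~a in a , y₀ , a∈A₁ , inj₂ y₀∈O , Adjacent-sym y₀~a
        adjacent 2<3 with Linked-successor (Linked-++⁻ʳ A₁ linked′) q′∈R
        ... | z , z∈R , d~z = d , z , refl , inj₁ z∈R , d~z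

        k4Model : K4Model G
        k4Model = branchSets⇒K4Model record
          { Branch = Branch ; branch? = branch? ; nonempty = nonempty ; connected = connected
          ; disjoint = disjoint ; adjacent = adjacent }

      bridge : K4Model G
      bridge with occurrences attached? vertices
      ... | none ¬att = noAttachment ¬att
      ... | one A c R eq ¬A att ¬R = oneAttachment A c R eq ¬A att ¬R
      ... | two A c B d R eq ¬A _ ¬B _ ¬R = TwoAttachments.k4Model A c B d R eq ¬A ¬B ¬R
      ... | many A d R eq q∈A att-q att-d q′∈R att-q′ = ManyAttachments.k4Model A d R eq q∈A att-q att-d q′∈R att-q′

    -- if the spine covers S, the interior vertex p₁ has a chord to a later vertex w ≠ p₂,
    -- and p₂ lies off the shortened spine
    shortcut : (σ : Spine) → (∀ {v} → v ∈ₛ S → v ∈ Spine.vertices σ) → K4Model G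
    shortcut (spine p₁ (p₂ ∷ R) linked (a≢ ∷ p₁≢ ∷ p₂≢ ∷ unique) (a∈S ∷ p₁∈S ∷ p₂∈S ∷ inS) last) S⊆σ
      with ThreeNeighbours.neighbourAvoiding (degree (p₁∈S , All.head a≢ ∘ sym , All.lookup p₁≢ (Last⇒∈ last))) a p₂
    ... | w , (p₁~w , w≢p₁) , w≢a , w≢p₂
      with S⊆σ (closed (p₁∈S , All.head a≢ ∘ sym , All.lookup p₁≢ (Last⇒∈ last)) p₁~w)
    ... | here w≡a                  = ⊥-elim (w≢a w≡a)
    ... | there (here w≡p₁)         = ⊥-elim (w≢p₁ w≡p₁)
    ... | there (there (here w≡p₂)) = ⊥-elim (w≢p₂ w≡p₂)
    ... | there (there (there w∈R)) with ∈-∃++ w∈R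
    ... | B , C , refl = Bridge.bridge σ′ p₂∈S p₂∉σ′
      where
      σ′ : Spine
      σ′ = spine p₁ (w ∷ C)
        (Linked.head linked ∷ p₁~w ∷ Linked-++⁻ʳ (p₂ ∷ B) (Linked.tail (Linked.tail linked)))
        ((All.head a≢ ∷ All-++⁻ʳ B (All.tail (All.tail a≢))) ∷ All-++⁻ʳ B (All.tail p₁≢) ∷ Unique-++⁻ʳ B unique)
        (a∈S ∷ p₁∈S ∷ All-++⁻ʳ B inS)
        (Last-++⁻ʳ (p₂ ∷ B) last)
      p₂∉σ′ : p₂ ∉ Spine.vertices σ′
      p₂∉σ′ (here p₂≡a)          = All.head (All.tail a≢) (sym p₂≡a)
      p₂∉σ′ (there (here p₂≡p₁)) = All.head p₁≢ (sym p₂≡p₁)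
      p₂∉σ′ (there (there p₂∈))  = All.lookup (All-++⁻ʳ B p₂≢) p₂∈ refl

    spine⇒K4 : Spine → K4Model G
    spine⇒K4 σ with any? (λ v → v ∈? S ×-dec ¬? (v ∈ₗ? Spine.vertices σ))
    ... | yes (y , y∈S , y∉σ) = Bridge.bridge σ y∈S y∉σ
    ... | no allOn            = shortcut σ onSpine
      where
      onSpine : ∀ {v} → v ∈ₛ S → v ∈ Spine.vertices σ
      onSpine {v} v∈S with v ∈ₗ? Spine.vertices σ
      ... | yes v∈σ = v∈σ
      ... | no v∉σ  = ⊥-elim (allOn (v , v∈S , v∉σ))

    module InteriorComponent {x} (x∈ : Interior S a b x) where
      open Component (component {subsetOf Interior?} (∈-subsetOf⁺ Interior? x∈)) public
        renaming (closed to C-closed)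

      C-interior : ∀ {w} → w ∈ₛ C → Interior S a b w
      C-interior = ∈-subsetOf⁻ Interior? ∘ C⊆T

      leaves : ∀ {w v} → w ∈ₛ C → w ~ v → v ≡ a ⊎ v ≡ b ⊎ v ∈ₛ C
      leaves {w} {v} w∈C w~v with v ≟ a | v ≟ b
      ... | yes v≡a | _       = inj₁ v≡a
      ... | no _    | yes v≡b = inj₂ (inj₁ v≡b)
      ... | no v≢a  | no v≢b  =
        inj₂ (inj₂ (C-closed w∈C (∈-subsetOf⁺ Interior? (closed (C-interior w∈C) w~v , v≢a , v≢b)) w~v))

    through-b : ∀ {x} → Interior S a b x → x ~ b → K4Model G
    through-b {x} x∈ x~b with any? (λ z → z ∈? C ×-dec z ~? a)
      where open InteriorComponent x∈
    ... | yes (z , z∈C , z~a) = spine⇒K4 (spine z (rest ++ b ∷ [])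
      (Adjacent-sym z~a ∷ Linked-∷ʳ linked last x~b)
      (¬Any⇒All¬ _ a∉ ∷ Unique-++⁺ unique ([] ∷ [])
                             (λ { (b∈ , here refl) → proj₂ (proj₂ (C-interior (All.lookup within b∈))) refl }))
      (a∈S ∷ All-++⁺ (All.map (proj₁ ∘ C-interior) within) (b∈S ∷ []))
      (Last-∷ʳ rest))
      where
      open InteriorComponent x∈
      open PathIn (pathTo z∈C)
      a∉ : a ∉ z ∷ rest ++ b ∷ []
      a∉ a∈ with ∈-++⁻ (z ∷ rest) a∈
      ... | inj₁ a∈C         = proj₁ (proj₂ (C-interior (All.lookup within a∈C))) refl
      ... | inj₂ (here a≡b) = a≢b a≡b
    ... | no ¬~a = pendant C C-interior b∈S r∈C x~b (proj₂ (proj₂ x∈)) internal a∈S a∉C a≢b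
      where
      open InteriorComponent x∈
      a∉C : a ∉ₛ C
      a∉C a∈C = proj₁ (proj₂ (C-interior a∈C)) refl
      internal : ∀ {w v} → w ∈ₛ C → w ~ v → v ∈ₛ C ⊎ v ≡ b
      internal {w} w∈C w~v with leaves w∈C w~v
      ... | inj₁ refl        = ⊥-elim (¬~a (w , w∈C , w~v))
      ... | inj₂ (inj₁ v≡b) = inj₂ v≡b
      ... | inj₂ (inj₂ v∈C) = inj₁ v∈C

    -- a component of the interior next to b yields a spine or hangs off b, one next to a only
    -- hangs off a, and one next to neither hangs off any of its vertices
    k4Model : K4Model G
    k4Model with any? (λ x → Interior? x ×-dec x ~? b)
    ... | yes (x , x∈ , x~b) = through-b x∈ x~b
    ... | no ¬~b with any? (λ x → Interior? x ×-dec x ~? a)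
    ...   | yes (x , x∈ , x~a) = pendant C C-interior a∈S r∈C x~a (proj₁ (proj₂ x∈)) internal b∈S b∉C (a≢b ∘ sym)
      where
      open InteriorComponent x∈
      b∉C : b ∉ₛ C
      b∉C b∈C = proj₂ (proj₂ (C-interior b∈C)) refl
      internal : ∀ {w v} → w ∈ₛ C → w ~ v → v ∈ₛ C ⊎ v ≡ a
      internal {w} w∈C w~v with leaves w∈C w~v
      ... | inj₁ v≡a         = inj₂ v≡a
      ... | inj₂ (inj₁ refl) = ⊥-elim (¬~b (w , C-interior w∈C , w~v))
      ... | inj₂ (inj₂ v∈C)  = inj₁ v∈C
    ...   | no ¬~a = pendant C C-interior (proj₁ t∈) n₁∈C (Adjacent-sym w~n₁) n₁≢w (λ w∈C w~v → inj₁ (stays w∈C w~v))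
                             a∈S a∉C (proj₁ (proj₂ t∈) ∘ sym)
      where
      t : V
      t = proj₁ hasInterior
      t∈ : Interior S a b t
      t∈ = proj₂ hasInterior
      open InteriorComponent t∈
      a∉C : a ∉ₛ C
      a∉C a∈C = proj₁ (proj₂ (C-interior a∈C)) refl
      stays : ∀ {w v} → w ∈ₛ C → w ~ v → v ∈ₛ C
      stays {w} w∈C w~v with leaves w∈C w~v
      ... | inj₁ refl        = ⊥-elim (¬~a (w , C-interior w∈C , w~v))
      ... | inj₂ (inj₁ refl) = ⊥-elim (¬~b (w , C-interior w∈C , w~v))
      ... | inj₂ (inj₂ v∈C)  = v∈C
      open ThreeNeighbours (degree t∈)
      n₁∈C : n₁ ∈ₛ C
      n₁∈C = stays r∈C w~n₁

  piece⇒K4Model : Piece → K4Model G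
  piece⇒K4Model π = go π (⊂-wellFounded (Piece.S π))
    where
    go : ∀ π → Acc _⊂_ (Piece.S π) → K4Model G
    go π (acc smaller) = InductionStep.k4Model π (λ π′ S′⊂S → go π′ (smaller S′⊂S))

  degreeThree⇒K4Model : ∀ {e u v} → Joins G e u v → u ≢ v →
                        (∀ {w} → w ≢ u → w ≢ v → ThreeNeighbours w) → ∃ (λ w → w ≢ u × w ≢ v) → K4Model G
  degreeThree⇒K4Model {e} {u} {v} j u≢v three (w , w≢u , w≢v) = piece⇒K4Model record
    { S = ⊤ ; a = u ; b = v ; a∈S = ∈⊤ ; b∈S = ∈⊤ ; a≢b = u≢v
    ; Outer = ⁅ v ⁆
    ; outer∩S = λ x∈ _ → x∈⁅y⁆⇒x≡y v x∈
    ; outerWalk = λ x∈ → subst (WalkIn (_∈ₛ ⁅ v ⁆) v) (sym (x∈⁅y⁆⇒x≡y v x∈)) (here (x∈⁅x⁆ v))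
    ; outer~a = v , x∈⁅x⁆ v , e , Sum.swap j
    ; degree = λ (_ , w≢u , w≢v) → three w≢u w≢v
    ; closed = λ _ _ → ∈⊤
    ; hasInterior = w , ∈⊤ , w≢u , w≢v }

-- Isomorphisms

to-injective : (I : A ↔ B) → ∀ {x y} → Inverse.to I x ≡ Inverse.to I y → x ≡ y
to-injective I {x} {y} e =
  trans (sym (Inverse.strictlyInverseʳ I x)) (trans (cong (Inverse.from I) e) (Inverse.strictlyInverseʳ I y))

Iso-sym : ∀ {P Q} → Iso P Q → Iso Q P
Iso-sym {P} {Q} I = record
  { vIso  = ↔-sym vIso
  ; eIso  = ↔-sym eIso
  ; ends≅ = λ i → SameEnds-sym (SameEnds-trans (SameEnds-map (Inverse.from vIso) (ends≅′ i))
                                               (inj₁ (from-to _ , from-to _)))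
  ; dist≅ = trans (cong (Inverse.from eIso) (sym dist≅)) (Inverse.strictlyInverseʳ eIso (dist P)) }
  where
  open Iso I
  from-to : ∀ x → Inverse.from vIso (Inverse.to vIso x) ≡ x
  from-to = Inverse.strictlyInverseʳ vIso
  ends≅′ : ∀ i → SameEnds (ends (graph Q) i) (mapPair (Inverse.to vIso) (ends (graph P) (Inverse.from eIso i)))
  ends≅′ i = subst (λ k → SameEnds (ends (graph Q) k) _) (Inverse.strictlyInverseˡ eIso i) (ends≅ (Inverse.from eIso i))

Iso-trans : ∀ {P Q R} → Iso P Q → Iso Q R → Iso P R
Iso-trans I J = record
  { vIso  = ↔-trans (Iso.vIso I) (Iso.vIso J)
  ; eIso  = ↔-trans (Iso.eIso I) (Iso.eIso J)
  ; ends≅ = λ i → SameEnds-trans (Iso.ends≅ J _) (SameEnds-map (Inverse.to (Iso.vIso J)) (Iso.ends≅ I i))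
  ; dist≅ = trans (cong (Inverse.to (Iso.eIso J)) (Iso.dist≅ I)) (Iso.dist≅ J) }

module _ {P Q : Pointed} (I : Iso P Q) where
  open Iso I
  private
    GP GQ : Graph
    GP = graph P
    GQ = graph Q
    φ : Fin (nV GP) → Fin (nV GQ)
    φ = Inverse.to vIso
    φ⁻ : Fin (nV GQ) → Fin (nV GP)
    φ⁻ = Inverse.from vIso

    φφ⁻ : ∀ y → φ (φ⁻ y) ≡ y
    φφ⁻ = Inverse.strictlyInverseˡ vIso

  Iso-walk : ∀ {X : Fin (nV GP) → Set} {R : Fin (nE GP) → Set} {X′ : Fin (nV GQ) → Set} {R′ : Fin (nE GQ) → Set} →
             (∀ {x} → X x → X′ (φ x)) → (∀ {i} → R i → R′ (Inverse.to eIso i)) →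
             ∀ {u v} → Walk GP X R u v → Walk GQ X′ R′ (φ u) (φ v)
  Iso-walk fx fr = mapʷ φ fx (λ i r j xu xw → edgeʷ _ (fr r) (Joins-transport GP GQ φ (ends≅ i) j) (fx xu) (fx xw))

  Iso-dist : SameEnds (ends GQ (dist Q)) (mapPair φ (ends GP (dist P)))
  Iso-dist = subst (λ k → SameEnds (ends GQ k) _) dist≅ (ends≅ (dist P))

  Iso-Connected : Connected GP → Connected GQ
  Iso-Connected (v₀ , walks) = φ v₀ , λ u v →
    subst₂ (Walk GQ (AllV GQ) (AllE GQ)) (φφ⁻ u) (φφ⁻ v) (Iso-walk _ _ (walks (φ⁻ u) (φ⁻ v)))

  Iso-¬IsBridge : ¬ IsBridge GP (dist P) → ¬ IsBridge GQ (dist Q)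
  Iso-¬IsBridge ¬bridge bridge = ¬bridge (bridge ∘ transport Iso-dist)
    where
    avoid : ∀ {i} → i ≢ dist P → Inverse.to eIso i ≢ dist Q
    avoid i≢d e = i≢d (to-injective eIso (trans e (sym dist≅)))
    transport : SameEnds (ends GQ (dist Q)) (mapPair φ (ends GP (dist P))) →
                Walk GP (AllV GP) (λ i → i ≢ dist P) (proj₁ (ends GP (dist P))) (proj₂ (ends GP (dist P))) →
                Walk GQ (AllV GQ) (λ i → i ≢ dist Q) (proj₁ (ends GQ (dist Q))) (proj₂ (ends GQ (dist Q)))
    transport (inj₁ (e₁ , e₂)) w = subst₂ (Walk GQ _ _) (sym e₁) (sym e₂) (Iso-walk _ avoid w)
    transport (inj₂ (e₁ , e₂)) w = subst₂ (Walk GQ _ _) (sym e₁) (sym e₂) (reverseʷ (Iso-walk _ avoid w))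

  Iso-¬IsLoop : ¬ IsLoop GP (dist P) → ¬ IsLoop GQ (dist Q)
  Iso-¬IsLoop ¬loop loop with Iso-dist
  ... | inj₁ (e₁ , e₂) = ¬loop (to-injective vIso (trans (sym e₁) (trans loop e₂)))
  ... | inj₂ (e₁ , e₂) = ¬loop (to-injective vIso (trans (sym e₂) (trans (sym loop) e₁)))

  Iso-K4Model : K4Model GP → K4Model GQ
  Iso-K4Model M = record
    { branch    = branch ∘ φ⁻
    ; nonempty  = λ k → φ (proj₁ (nonempty k)) , trans (cong branch (φ⁻φ _)) (proj₂ (nonempty k))
    ; connected = λ k u v bu bv → subst₂ (Walk GQ _ _) (φφ⁻ u) (φφ⁻ v)
        (Iso-walk (λ {x} bx → trans (cong branch (φ⁻φ x)) bx) _ (connected k (φ⁻ u) (φ⁻ v) bu bv))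
    ; adjacent  = adjacent′ }
    where
    open K4Model M
    φ⁻φ : ∀ x → φ⁻ (φ x) ≡ x
    φ⁻φ = Inverse.strictlyInverseʳ vIso
    adjacent′ : (k l : Fin 4) → k ≢ l →
                Σ (Fin (nE GQ)) λ i → Σ (Fin (nV GQ)) λ u → Σ (Fin (nV GQ)) λ w →
                  Joins GQ i u w × branch (φ⁻ u) ≡ just k × branch (φ⁻ w) ≡ just l
    adjacent′ k l k≢l with adjacent k l k≢l
    ... | i , u , w , j , bu , bw = Inverse.to eIso i , φ u , φ w , Joins-transport GP GQ φ (ends≅ i) j ,
                                    trans (cong branch (φ⁻φ u)) bu , trans (cong branch (φ⁻φ w)) bw

InG′-resp-Iso : ∀ {P Q} → Iso P Q → InG′ P → InG′ Q
InG′-resp-Iso I (connected , seriesParallel , ¬bridge , ¬loop) =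
  Iso-Connected I connected , seriesParallel ∘ Iso-K4Model (Iso-sym I) , Iso-¬IsBridge I ¬bridge , Iso-¬IsLoop I ¬loop

subdivide-ends-≡ : ∀ P j i → i ≡ j → ends (graph (subdivide P j)) (suc i) ≡ (suc (proj₁ (ends (graph P) j)) , zero)
subdivide-ends-≡ P j i i≡j with i ≟ j
... | yes _   = refl
... | no i≢j = ⊥-elim (i≢j i≡j)

subdivide-ends-≢ : ∀ P j i → i ≢ j → ends (graph (subdivide P j)) (suc i) ≡ mapPair suc (ends (graph P) i)
subdivide-ends-≢ P j i i≢j with i ≟ j
... | yes i≡j = ⊥-elim (i≢j i≡j)
... | no _    = refl

transpose-0-suc : ∀ {n} (j : Fin n) → PC.transpose zero (suc j) (suc j) ≡ zero
transpose-0-suc j rewrite dec-true (j ≟ j) refl = refl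

transpose-0-other : ∀ {n} (j k : Fin n) → k ≢ j → PC.transpose zero (suc j) (suc k) ≡ suc k
transpose-0-other j k k≢j rewrite dec-false (k ≟ j) k≢j = refl

Step-transport : ∀ {R P Q} → Iso R P → Step P Q → Σ Pointed λ R′ → Step R R′ × Iso R′ Q
Step-transport {R} I (loopAdd P v) = addLoop R (φ⁻ v) , loopAdd R (φ⁻ v) , record
  { vIso = vIso ; eIso = lift₀ eIso ; ends≅ = ends≅′ ; dist≅ = cong suc dist≅ }
  where
  open Iso I
  φ⁻ : Fin (nV (graph P)) → Fin (nV (graph R))
  φ⁻ = Inverse.from vIso
  ends≅′ : ∀ i → SameEnds (ends (graph (addLoop P v)) (Inverse.to (lift₀ eIso) i))
                          (mapPair (Inverse.to vIso) (ends (graph (addLoop R (φ⁻ v))) i))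
  ends≅′ zero    = inj₁ (sym (Inverse.strictlyInverseˡ vIso v) , sym (Inverse.strictlyInverseˡ vIso v))
  ends≅′ (suc i) = ends≅ i
Step-transport {R} I (leafAdd P v) = addLeaf R (φ⁻ v) , leafAdd R (φ⁻ v) , record
  { vIso = lift₀ vIso ; eIso = lift₀ eIso ; ends≅ = ends≅′ ; dist≅ = cong suc dist≅ }
  where
  open Iso I
  φ⁻ : Fin (nV (graph P)) → Fin (nV (graph R))
  φ⁻ = Inverse.from vIso
  ends≅′ : ∀ i → SameEnds (ends (graph (addLeaf P v)) (Inverse.to (lift₀ eIso) i))
                          (mapPair (Inverse.to (lift₀ vIso)) (ends (graph (addLeaf R (φ⁻ v))) i))
  ends≅′ zero    = inj₁ (refl , cong suc (sym (Inverse.strictlyInverseˡ vIso v)))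
  ends≅′ (suc i) = SameEnds-map suc (ends≅ i)
Step-transport {R} I (dupl P j j≢d) = duplicate R (ψ j) , dupl R (ψ j) ψj≢d , record
  { vIso = vIso ; eIso = lift₀ eIso ; ends≅ = ends≅′ ; dist≅ = cong suc dist≅ }
  where
  open Iso I
  ψ : Fin (nE (graph P)) → Fin (nE (graph R))
  ψ = Inverse.from eIso
  ψj≢d : ψ j ≢ dist R
  ψj≢d e = j≢d (trans (sym (Inverse.strictlyInverseˡ eIso j)) (trans (cong (Inverse.to eIso) e) dist≅))
  ends≅′ : ∀ i → SameEnds (ends (graph (duplicate P j)) (Inverse.to (lift₀ eIso) i))
                          (mapPair (Inverse.to vIso) (ends (graph (duplicate R (ψ j))) i))
  ends≅′ zero    = subst (λ k → SameEnds (ends (graph P) k) (mapPair (Inverse.to vIso) (ends (graph R) (ψ j))))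
                         (Inverse.strictlyInverseˡ eIso j) (ends≅ (ψ j))
  ends≅′ (suc i) = ends≅ i
Step-transport {R} I (subdiv P j j≢d) = subdivide R j′ , subdiv R j′ j′≢d , iso (ends≅ j′)
  where
  open Iso I
  j′ : Fin (nE (graph R))
  j′ = Inverse.from eIso j
  τ : Fin (nE (graph R)) → Fin (nE (graph P))
  τ = Inverse.to eIso
  τj′ : τ j′ ≡ j
  τj′ = Inverse.strictlyInverseˡ eIso j
  j′≢d : j′ ≢ dist R
  j′≢d e = j≢d (trans (sym τj′) (trans (cong τ e) dist≅))
  τ≢ : ∀ {i} → i ≢ j′ → τ i ≢ j
  τ≢ {i} i≢j′ e = i≢j′ (trans (sym (Inverse.strictlyInverseʳ eIso i)) (cong (Inverse.from eIso) e))
  GS GR : Graph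
  GS = graph (subdivide P j)
  GR = graph (subdivide R j′)
  ψ : Fin (nV GR) → Fin (nV GS)
  ψ = Inverse.to (lift₀ vIso)
  sub≡ : ∀ {i} → i ≡ j′ → ends GR (suc i) ≡ (suc (proj₁ (ends (graph R) j′)) , zero)
  sub≡ = subdivide-ends-≡ R j′ _
  sub≢ : ∀ i → i ≢ j′ → SameEnds (ends GS (suc (τ i))) (mapPair ψ (ends GR (suc i)))
  sub≢ i i≢j′ = SameEnds-≡ˡ (subdivide-ends-≢ P j (τ i) (τ≢ i≢j′))
                  (SameEnds-≡ʳ (cong (mapPair ψ) (subdivide-ends-≢ R j′ i i≢j′)) (SameEnds-map suc (ends≅ i)))
  -- if the isomorphism reverses the subdivided edge, the two halves change places
  iso : SameEnds (ends (graph P) (τ j′)) (mapPair (Inverse.to vIso) (ends (graph R) j′)) → Iso (subdivide R j′) (subdivide P j)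
  iso se with subst (λ k → SameEnds (ends (graph P) k) (mapPair (Inverse.to vIso) (ends (graph R) j′))) τj′ se
  ... | inj₁ (e₁ , e₂) = record { vIso = lift₀ vIso ; eIso = lift₀ eIso ; ends≅ = ends≅′ ; dist≅ = cong suc dist≅ }
    where
    ends≅′ : ∀ i → SameEnds (ends GS (Inverse.to (lift₀ eIso) i)) (mapPair ψ (ends GR i))
    ends≅′ zero = inj₁ (refl , cong suc e₂)
    ends≅′ (suc i) = half i (i ≟ j′)
      where
      half : ∀ i → Dec (i ≡ j′) → SameEnds (ends GS (suc (τ i))) (mapPair ψ (ends GR (suc i)))
      half i (yes i≡j′) = SameEnds-≡ˡ (subdivide-ends-≡ P j (τ i) (trans (cong τ i≡j′) τj′))
                            (SameEnds-≡ʳ (cong (mapPair ψ) (sub≡ i≡j′)) (inj₁ (cong suc e₁ , refl)))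
      half i (no i≢j′)  = sub≢ i i≢j′
  ... | inj₂ (e₁ , e₂) = record
    { vIso = lift₀ vIso ; eIso = ↔-trans (lift₀ eIso) (transpose zero (suc j)) ; ends≅ = ends≅′ ; dist≅ = dist≅′ }
    where
    swap : Fin (nE GS) → Fin (nE GS)
    swap = PC.transpose zero (suc j)
    ends≅′ : ∀ i → SameEnds (ends GS (swap (Inverse.to (lift₀ eIso) i))) (mapPair ψ (ends GR i))
    ends≅′ zero = SameEnds-≡ˡ (subdivide-ends-≡ P j j refl) (inj₂ (cong suc e₁ , refl))
    ends≅′ (suc i) = half i (i ≟ j′)
      where
      half : ∀ i → Dec (i ≡ j′) → SameEnds (ends GS (swap (suc (τ i)))) (mapPair ψ (ends GR (suc i)))
      half i (yes i≡j′) = SameEnds-≡ˡ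
                            (cong (ends GS) (trans (cong (swap ∘ suc) (trans (cong τ i≡j′) τj′)) (transpose-0-suc j)))
                            (SameEnds-≡ʳ (cong (mapPair ψ) (sub≡ i≡j′)) (inj₂ (refl , cong suc e₂)))
      half i (no i≢j′)  = SameEnds-≡ˡ (cong (ends GS) (transpose-0-other j (τ i) (τ≢ i≢j′))) (sub≢ i i≢j′)
    dist≅′ : swap (suc (τ (dist R))) ≡ suc (dist P)
    dist≅′ = trans (transpose-0-other j (τ (dist R)) (λ e → j≢d (trans (sym e) dist≅))) (cong suc dist≅)

-- Undoing an operation

SameEnds-loop : ∀ {v u w : A} → SameEnds (v , v) (u , w) → u ≡ w
SameEnds-loop (inj₁ (refl , refl)) = refl
SameEnds-loop (inj₂ (refl , refl)) = refl

-- φ contracts the connected fibres of a vertex map onto the vertices of P and deletes edges,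
-- so that P is a minor of Q
record Contraction (P Q : Pointed) : Set₁ where
  field
    φ           : Fin (nV (graph Q)) → Fin (nV (graph P))
    ψ           : Fin (nV (graph P)) → Fin (nV (graph Q))
    φψ          : ∀ x → φ (ψ x) ≡ x
    dist-ends   : mapPair φ (ends (graph Q) (dist Q)) ≡ ends (graph P) (dist P)
    edgeWalk    : ∀ {u w} i → i ≢ dist Q → Joins (graph Q) i u w →
                  Walk (graph P) (AllV (graph P)) (λ k → k ≢ dist P) (φ u) (φ w)
    liftEdge    : ∀ (X : Fin (nV (graph P)) → Set) {x y} i → Joins (graph P) i x y → X x → X y →
                  Walk (graph Q) (X ∘ φ) (AllE (graph Q)) (ψ x) (ψ y)
    fibreWalk   : ∀ (X : Fin (nV (graph P)) → Set) u → X (φ u) →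
                  Walk (graph Q) (X ∘ φ) (AllE (graph Q)) u (ψ (φ u))
    liftJoins   : ∀ i {x y} → Joins (graph P) i x y →
                  Σ (Fin (nE (graph Q))) λ k → Σ (Fin (nV (graph Q))) λ u → Σ (Fin (nV (graph Q))) λ w →
                    Joins (graph Q) k u w × φ u ≡ x × φ w ≡ y
    dist-loop   : IsLoop (graph P) (dist P) → IsLoop (graph Q) (dist Q)

module _ {P Q : Pointed} (C : Contraction P Q) where
  open Contraction C
  private
    GP GQ : Graph
    GP = graph P
    GQ = graph Q

  contract-edge : ∀ {u w} i → Joins GQ i u w → Walk GP (AllV GP) (AllE GP) (φ u) (φ w)
  contract-edge i j with i ≟ dist Q
  ... | no i≢d    = weakenʷ id (λ _ → tt) (edgeWalk i i≢d j)
  ... | yes refl = edgeʷ (dist P) tt (SameEnds⇒Joins GP (SameEnds-≡ˡ (sym dist-ends) (SameEnds-map φ (Joins⇒SameEnds GQ j)))) tt tt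

  Contraction-Connected : Connected GQ → Connected GP
  Contraction-Connected (v₀ , walks) = φ v₀ , λ x y →
    subst₂ (Walk GP _ _) (φψ x) (φψ y) (mapʷ φ id (λ i _ j _ _ → contract-edge i j) (walks (ψ x) (ψ y)))

  Contraction-¬IsBridge : ¬ IsBridge GQ (dist Q) → ¬ IsBridge GP (dist P)
  Contraction-¬IsBridge ¬bridge bridge = ¬bridge λ w →
    bridge (subst₂ (Walk GP _ _) (cong proj₁ dist-ends) (cong proj₂ dist-ends)
                   (mapʷ φ id (λ i i≢d j _ _ → edgeWalk i i≢d j) w))

  Contraction-K4Model : K4Model GP → K4Model GQ
  Contraction-K4Model M = record
    { branch    = branch ∘ φ
    ; nonempty  = λ k → ψ (proj₁ (nonempty k)) , trans (cong branch (φψ _)) (proj₂ (nonempty k))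
    ; connected = connected′
    ; adjacent  = adjacent′ }
    where
    open K4Model M
    connected′ : (k : Fin 4) → ∀ u v → branch (φ u) ≡ just k → branch (φ v) ≡ just k →
                 Walk GQ (λ x → branch (φ x) ≡ just k) (AllE GQ) u v
    connected′ k u v bu bv =
      fibreWalk X u bu
      ++ʷ mapʷ ψ (λ {x} bx → trans (cong branch (φψ x)) bx) (λ i _ j bx by → liftEdge X i j bx by)
               (connected k (φ u) (φ v) bu bv)
      ++ʷ reverseʷ (fibreWalk X v bv)
      where
      X : Fin (nV GP) → Set
      X x = branch x ≡ just k
    adjacent′ : (k l : Fin 4) → k ≢ l →
                Σ (Fin (nE GQ)) λ i → Σ (Fin (nV GQ)) λ u → Σ (Fin (nV GQ)) λ w →
                  Joins GQ i u w × branch (φ u) ≡ just k × branch (φ w) ≡ just l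
    adjacent′ k l k≢l with adjacent k l k≢l
    ... | i , x , y , j , bx , by with liftJoins i j
    ...   | i′ , u , w , j′ , refl , refl = i′ , u , w , j′ , bx , by

  InG′-reflect : InG′ Q → InG′ P
  InG′-reflect (connected , seriesParallel , ¬bridge , ¬loop) =
    Contraction-Connected connected , seriesParallel ∘ Contraction-K4Model ,
    Contraction-¬IsBridge ¬bridge , ¬loop ∘ dist-loop

loopContraction : ∀ P v → Contraction P (addLoop P v)
loopContraction P v = record
  { φ = id ; ψ = id ; φψ = λ _ → refl ; dist-ends = refl
  ; edgeWalk  = edgeWalk
  ; liftEdge  = λ X i j Xx Xy → edgeʷ (suc i) tt j Xx Xy
  ; fibreWalk = λ X u Xu → here Xu
  ; liftJoins = λ i j → suc i , _ , _ , j , refl , refl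
  ; dist-loop = id }
  where
  GP GQ : Graph
  GP = graph P
  GQ = graph (addLoop P v)
  edgeWalk : ∀ {u w} i → i ≢ suc (dist P) → Joins GQ i u w → Walk GP (AllV GP) (λ k → k ≢ dist P) u w
  edgeWalk zero    _   j = subst (Walk GP _ _ _) (SameEnds-loop (Joins⇒SameEnds GQ {zero} j)) (here tt)
  edgeWalk (suc i) i≢d j = edgeʷ i (i≢d ∘ cong suc) j tt tt

duplicateContraction : ∀ P j → j ≢ dist P → Contraction P (duplicate P j)
duplicateContraction P j₀ j₀≢d = record
  { φ = id ; ψ = id ; φψ = λ _ → refl ; dist-ends = refl
  ; edgeWalk  = edgeWalk
  ; liftEdge  = λ X i j Xx Xy → edgeʷ (suc i) tt j Xx Xy
  ; fibreWalk = λ X u Xu → here Xu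
  ; liftJoins = λ i j → suc i , _ , _ , j , refl , refl
  ; dist-loop = id }
  where
  GP GQ : Graph
  GP = graph P
  GQ = graph (duplicate P j₀)
  edgeWalk : ∀ {u w} i → i ≢ suc (dist P) → Joins GQ i u w → Walk GP (AllV GP) (λ k → k ≢ dist P) u w
  edgeWalk zero    _   j = edgeʷ j₀ j₀≢d j tt tt
  edgeWalk (suc i) i≢d j = edgeʷ i (i≢d ∘ cong suc) j tt tt

leafContraction : ∀ P v → Contraction P (addLeaf P v)
leafContraction P v = record
  { φ = φ ; ψ = suc ; φψ = λ _ → refl ; dist-ends = refl
  ; edgeWalk  = edgeWalk
  ; liftEdge  = λ X i j Xx Xy → edgeʷ (suc i) tt (Joins-transport GP GQ suc {i} {suc i} (SameEnds-refl _) j) Xx Xy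
  ; fibreWalk = fibreWalk
  ; liftJoins = λ i j → suc i , _ , _ , Joins-transport GP GQ suc {i} {suc i} (SameEnds-refl _) j , refl , refl
  ; dist-loop = cong suc }
  where
  GP GQ : Graph
  GP = graph P
  GQ = graph (addLeaf P v)
  φ : Fin (suc (nV GP)) → Fin (nV GP)
  φ zero    = v
  φ (suc x) = x
  edgeWalk : ∀ {u w} i → i ≢ suc (dist P) → Joins GQ i u w → Walk GP (AllV GP) (λ k → k ≢ dist P) (φ u) (φ w)
  edgeWalk zero    _   (inj₁ refl) = here tt
  edgeWalk zero    _   (inj₂ refl) = here tt
  edgeWalk (suc i) i≢d j           = edgeʷ i (i≢d ∘ cong suc) (Joins-transport GQ GP φ {suc i} {i} (SameEnds-refl _) j) tt tt
  fibreWalk : ∀ (X : Fin (nV GP) → Set) u → X (φ u) → Walk GQ (X ∘ φ) (AllE GQ) u (suc (φ u))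
  fibreWalk X zero    Xu = edgeʷ zero tt (inj₁ refl) Xu Xu
  fibreWalk X (suc x) Xu = here Xu

subdivideContraction : ∀ P j → j ≢ dist P → Contraction P (subdivide P j)
subdivideContraction P j₀ j₀≢d = record
  { φ = φ ; ψ = suc ; φψ = λ _ → refl
  ; dist-ends = cong (mapPair φ) ends-d
  ; edgeWalk  = edgeWalk
  ; liftEdge  = λ X i j Xx Xy → liftEdge X i (i ≟ j₀) j Xx Xy
  ; fibreWalk = fibreWalk
  ; liftJoins = λ i j → liftJoins i (i ≟ j₀) j
  ; dist-loop = λ loop → trans (cong proj₁ ends-d) (trans (cong suc loop) (sym (cong proj₂ ends-d))) }
  where
  GP GQ : Graph
  GP = graph P
  GQ = graph (subdivide P j₀)
  x y : Fin (nV GP)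
  x = proj₁ (ends GP j₀)
  y = proj₂ (ends GP j₀)
  φ : Fin (suc (nV GP)) → Fin (nV GP)
  φ zero    = x
  φ (suc z) = z
  ends-d : ends GQ (suc (dist P)) ≡ mapPair suc (ends GP (dist P))
  ends-d = subdivide-ends-≢ P j₀ (dist P) (j₀≢d ∘ sym)
  old : ∀ i → i ≢ j₀ → SameEnds (ends GQ (suc i)) (mapPair suc (ends GP i))
  old i i≢j₀ = SameEnds-≡ˡ (subdivide-ends-≢ P j₀ i i≢j₀) (SameEnds-refl _)
  secondHalf : ∀ i → i ≡ j₀ → SameEnds (ends GQ (suc i)) (suc x , zero)
  secondHalf i i≡j₀ = SameEnds-≡ˡ (subdivide-ends-≡ P j₀ i i≡j₀) (SameEnds-refl _)
  edgeWalk : ∀ {u w} i → i ≢ suc (dist P) → Joins GQ i u w → Walk GP (AllV GP) (λ k → k ≢ dist P) (φ u) (φ w)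
  edgeWalk zero    _   j = edgeʷ j₀ j₀≢d (Joins-transport GQ GP φ {zero} {j₀} (SameEnds-refl _) j) tt tt
  edgeWalk {u} {w} (suc i) i≢d j = halfWalk (i ≟ j₀)
    where
    halfWalk : Dec (i ≡ j₀) → Walk GP (AllV GP) (λ k → k ≢ dist P) (φ u) (φ w)
    halfWalk (yes i≡j₀) = subst (Walk GP _ _ _)
      (SameEnds-loop (SameEnds-trans (SameEnds-map φ (SameEnds-sym (secondHalf i i≡j₀)))
                                     (SameEnds-map φ (Joins⇒SameEnds GQ {suc i} j))))
      (here tt)
    halfWalk (no i≢j₀)  =
      edgeʷ i (i≢d ∘ cong suc) (Joins-transport GQ GP φ {suc i} {i} (SameEnds-sym (SameEnds-map φ (old i i≢j₀))) j) tt tt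

  liftEdge : ∀ (X : Fin (nV GP) → Set) {a c} i → Dec (i ≡ j₀) → Joins GP i a c → X a → X c →
             Walk GQ (X ∘ φ) (AllE GQ) (suc a) (suc c)
  liftEdge X i (no i≢j₀) j Xa Xc = edgeʷ (suc i) tt (Joins-transport GP GQ suc {i} {suc i} (old i i≢j₀) j) Xa Xc
  liftEdge X i (yes refl) j Xa Xc with Joins⇒SameEnds GP j
  ... | inj₁ (refl , refl) = step (suc j₀) tt (SameEnds⇒Joins GQ (secondHalf j₀ refl)) Xa (edgeʷ zero tt (inj₁ refl) Xa Xc)
  ... | inj₂ (refl , refl) = step zero tt (inj₂ refl) Xa
                               (edgeʷ (suc j₀) tt (SameEnds⇒Joins GQ (SameEnds-trans (secondHalf j₀ refl) (inj₂ (refl , refl)))) Xc Xc)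
  fibreWalk : ∀ (X : Fin (nV GP) → Set) u → X (φ u) → Walk GQ (X ∘ φ) (AllE GQ) u (suc (φ u))
  fibreWalk X zero    Xu = edgeʷ (suc j₀) tt (SameEnds⇒Joins GQ (SameEnds-trans (secondHalf j₀ refl) (inj₂ (refl , refl)))) Xu Xu
  fibreWalk X (suc z) Xu = here Xu
  liftJoins : ∀ i → Dec (i ≡ j₀) → ∀ {a c} → Joins GP i a c →
              Σ (Fin (nE GQ)) λ k → Σ (Fin (nV GQ)) λ u → Σ (Fin (nV GQ)) λ w → Joins GQ k u w × φ u ≡ a × φ w ≡ c
  liftJoins i (no i≢j₀) j = suc i , _ , _ , Joins-transport GP GQ suc {i} {suc i} (old i i≢j₀) j , refl , refl
  liftJoins i (yes refl) j with Joins⇒SameEnds GP j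
  ... | inj₁ (refl , refl) = zero , zero , suc y , inj₁ refl , refl , refl
  ... | inj₂ (refl , refl) = zero , suc y , zero , inj₂ refl , refl , refl

Step⇒Contraction : ∀ {P Q} → Step P Q → Contraction P Q
Step⇒Contraction (loopAdd P v)    = loopContraction P v
Step⇒Contraction (leafAdd P v)    = leafContraction P v
Step⇒Contraction (dupl P j j≢d)   = duplicateContraction P j j≢d
Step⇒Contraction (subdiv P j j≢d) = subdivideContraction P j j≢d

-- Reductions

pointed : ∀ {nv ne} → (Fin ne → Fin nv × Fin nv) → Fin ne → Pointed
pointed en d = record { graph = record { nV = _ ; nE = _ ; ends = en } ; dist = d }

record Reduction (P : Pointed) : Set₁ where
  field
    {smaller result} : Pointed
    operation        : Step smaller result
    iso              : Iso result P
    fewer            : nE (graph smaller) < nE (graph P)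

-- the permutation putting i in front: 0 ↦ i and suc k ↦ punchIn i k
toFront : ∀ {n} → Fin (suc n) → Permutation′ (suc n)
toFront i = insert zero i Perm.id

toFront-suc : ∀ {n} (i : Fin (suc n)) k → toFront i ⟨$⟩ʳ suc k ≡ punchIn i k
toFront-suc i = insert-punchIn zero i Perm.id

toFront-mapPair-suc : ∀ {n} (w : Fin (suc n)) p → mapPair (toFront w ⟨$⟩ʳ_) (mapPair suc p) ≡ mapPair (punchIn w) p
toFront-mapPair-suc w p = cong₂ _,_ (toFront-suc w _) (toFront-suc w _)

removeVertex : ∀ {n} (w : Fin (suc n)) (p : Fin (suc n) × Fin (suc n)) → w ≢ proj₁ p → w ≢ proj₂ p → Fin n × Fin n
removeVertex w p w≢₁ w≢₂ = punchOut w≢₁ , punchOut w≢₂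

removeVertex-punchIn : ∀ {n} (w : Fin (suc n)) p (w≢₁ : w ≢ proj₁ p) (w≢₂ : w ≢ proj₂ p) →
                       mapPair (punchIn w) (removeVertex w p w≢₁ w≢₂) ≡ p
removeVertex-punchIn w p w≢₁ w≢₂ = cong₂ _,_ (punchIn-punchOut w≢₁) (punchIn-punchOut w≢₂)

module Reductions {nv ne : ℕ} (en : Fin (suc ne) → Fin (suc nv) × Fin (suc nv)) (d : Fin (suc ne)) where

  P : Pointed
  P = pointed en d

  G : Graph
  G = graph P

  Incident : Fin (suc nv) → Fin (suc ne) → Set
  Incident w k = proj₁ (en k) ≡ w ⊎ proj₂ (en k) ≡ w

  private
    dist≅ : ∀ {ℓ} (ℓ≢d : ℓ ≢ d) → toFront ℓ ⟨$⟩ʳ suc (punchOut ℓ≢d) ≡ d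
    dist≅ ℓ≢d = trans (toFront-suc _ _) (punchIn-punchOut ℓ≢d)

    withoutEdge : ∀ {ℓ} → ℓ ≢ d → Pointed
    withoutEdge {ℓ} ℓ≢d = pointed (en ∘ punchIn ℓ) (punchOut ℓ≢d)

  loopReduction : ∀ ℓ → ℓ ≢ d → IsLoop G ℓ → Reduction P
  loopReduction ℓ ℓ≢d loop = record
    { operation = loopAdd (withoutEdge ℓ≢d) (proj₁ (en ℓ)) ; iso = iso ; fewer = n<1+n ne }
    where
    iso : Iso (addLoop (withoutEdge ℓ≢d) (proj₁ (en ℓ))) P
    iso = record { vIso = Perm.id ; eIso = toFront ℓ ; ends≅ = ends≅ ; dist≅ = dist≅ ℓ≢d }
      where
      ends≅ : ∀ k → SameEnds (en (toFront ℓ ⟨$⟩ʳ k))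
                             (mapPair id (ends (graph (addLoop (withoutEdge ℓ≢d) (proj₁ (en ℓ)))) k))
      ends≅ zero    = inj₁ (refl , sym loop)
      ends≅ (suc k) = SameEnds-≡ˡ (cong en (toFront-suc ℓ k)) (SameEnds-refl _)

  parallelReduction : ∀ ℓ ℓ′ → ℓ ≢ ℓ′ → ℓ ≢ d → ℓ′ ≢ d → SameEnds (en ℓ) (en ℓ′) → Reduction P
  parallelReduction ℓ ℓ′ ℓ≢ℓ′ ℓ≢d ℓ′≢d same = record
    { operation = dupl (withoutEdge ℓ≢d) (punchOut ℓ≢ℓ′) (ℓ′≢d ∘ punchOut-injective ℓ≢ℓ′ ℓ≢d)
    ; iso = iso ; fewer = n<1+n ne }
    where
    iso : Iso (duplicate (withoutEdge ℓ≢d) (punchOut ℓ≢ℓ′)) P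
    iso = record { vIso = Perm.id ; eIso = toFront ℓ ; ends≅ = ends≅ ; dist≅ = dist≅ ℓ≢d }
      where
      ends≅ : ∀ k → SameEnds (en (toFront ℓ ⟨$⟩ʳ k))
                             (mapPair id (ends (graph (duplicate (withoutEdge ℓ≢d) (punchOut ℓ≢ℓ′))) k))
      ends≅ zero    = SameEnds-≡ʳ (cong en (punchIn-punchOut ℓ≢ℓ′)) same
      ends≅ (suc k) = SameEnds-≡ˡ (cong en (toFront-suc ℓ k)) (SameEnds-refl _)

  leafReduction : ∀ w ℓ o → ℓ ≢ d → w ≢ o → Joins G ℓ w o → (∀ k → Incident w k → k ≡ ℓ) → Reduction P
  leafReduction w ℓ o ℓ≢d w≢o joins only = record
    { operation = leafAdd P′ (punchOut w≢o) ; iso = iso ; fewer = n<1+n ne }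
    where
    off : ∀ k → w ≢ proj₁ (en (punchIn ℓ k)) × w ≢ proj₂ (en (punchIn ℓ k))
    off k = (λ e → punchInᵢ≢i ℓ k (only _ (inj₁ (sym e)))) , (λ e → punchInᵢ≢i ℓ k (only _ (inj₂ (sym e))))
    P′ : Pointed
    P′ = pointed (λ k → removeVertex w (en (punchIn ℓ k)) (proj₁ (off k)) (proj₂ (off k))) (punchOut ℓ≢d)
    iso : Iso (addLeaf P′ (punchOut w≢o)) P
    iso = record { vIso = toFront w ; eIso = toFront ℓ ; ends≅ = ends≅ ; dist≅ = dist≅ ℓ≢d }
      where
      σ : Fin (suc nv) → Fin (suc nv)
      σ = toFront w ⟨$⟩ʳ_
      ends≅ : ∀ k → SameEnds (en (toFront ℓ ⟨$⟩ʳ k)) (mapPair σ (ends (graph (addLeaf P′ (punchOut w≢o))) k))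
      ends≅ zero    = SameEnds-trans (Joins⇒SameEnds G joins)
                        (inj₁ (refl , trans (sym (punchIn-punchOut w≢o)) (sym (toFront-suc w _))))
      ends≅ (suc k) = SameEnds-≡ˡ (cong en (toFront-suc ℓ k))
                        (SameEnds-≡ʳ (toFront-mapPair-suc w _)
                          (SameEnds-≡ʳ (removeVertex-punchIn w _ (proj₁ (off k)) (proj₂ (off k))) (SameEnds-refl _)))

  -- P′ forgets z and ℓ₂ and lets ℓ₁ join x and y directly
  seriesReduction : ∀ z ℓ₁ ℓ₂ x y → ℓ₁ ≢ ℓ₂ → ℓ₁ ≢ d → ℓ₂ ≢ d → z ≢ x → z ≢ y →
                    Joins G ℓ₁ z x → Joins G ℓ₂ z y → (∀ k → Incident z k → k ≡ ℓ₁ ⊎ k ≡ ℓ₂) → Reduction P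
  seriesReduction z ℓ₁ ℓ₂ x y ℓ₁≢ℓ₂ ℓ₁≢d ℓ₂≢d z≢x z≢y j₁ j₂ only = record
    { operation = subdiv P′ j (ℓ₁≢d ∘ punchOut-injective (ℓ₁≢ℓ₂ ∘ sym) ℓ₂≢d) ; iso = iso ; fewer = n<1+n ne }
    where
    j : Fin ne
    j = punchOut (ℓ₁≢ℓ₂ ∘ sym)
    off : ∀ k → k ≢ j → z ≢ proj₁ (en (punchIn ℓ₂ k)) × z ≢ proj₂ (en (punchIn ℓ₂ k))
    off k k≢j = (λ e → notIncident (inj₁ (sym e))) , (λ e → notIncident (inj₂ (sym e)))
      where
      notIncident : ¬ Incident z (punchIn ℓ₂ k)
      notIncident inc with only _ inc
      ... | inj₁ e = k≢j (punchIn-injective ℓ₂ k j (trans e (sym (punchIn-punchOut (ℓ₁≢ℓ₂ ∘ sym)))))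
      ... | inj₂ e = punchInᵢ≢i ℓ₂ k e
    ends′ : ∀ k → Dec (k ≡ j) → Fin nv × Fin nv
    ends′ k (yes _)  = punchOut z≢x , punchOut z≢y
    ends′ k (no k≢j) = removeVertex z (en (punchIn ℓ₂ k)) (proj₁ (off k k≢j)) (proj₂ (off k k≢j))
    ends′-j : (dec : Dec (j ≡ j)) → ends′ j dec ≡ (punchOut z≢x , punchOut z≢y)
    ends′-j (yes _)  = refl
    ends′-j (no j≢j) = ⊥-elim (j≢j refl)
    ends′-other : ∀ k → k ≢ j → (dec : Dec (k ≡ j)) → mapPair (punchIn z) (ends′ k dec) ≡ en (punchIn ℓ₂ k)
    ends′-other k k≢j (yes k≡j) = ⊥-elim (k≢j k≡j)
    ends′-other k _   (no k≢j)  = removeVertex-punchIn z _ (proj₁ (off k k≢j)) (proj₂ (off k k≢j))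
    P′ : Pointed
    P′ = pointed (λ k → ends′ k (k ≟ j)) (punchOut ℓ₂≢d)
    GQ : Graph
    GQ = graph (subdivide P′ j)
    σ : Fin (suc nv) → Fin (suc nv)
    σ = toFront z ⟨$⟩ʳ_
    iso : Iso (subdivide P′ j) P
    iso = record { vIso = toFront z ; eIso = toFront ℓ₂ ; ends≅ = ends≅ ; dist≅ = dist≅ ℓ₂≢d }
      where
      ends≅ : ∀ k → SameEnds (en (toFront ℓ₂ ⟨$⟩ʳ k)) (mapPair σ (ends GQ k))
      ends≅ zero    = SameEnds-trans (Joins⇒SameEnds G j₂)
                        (inj₁ (refl , trans (sym (punchIn-punchOut z≢y))
                                            (trans (cong (punchIn z ∘ proj₂) (sym (ends′-j (j ≟ j)))) (sym (toFront-suc z _)))))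
      ends≅ (suc k) = SameEnds-≡ˡ (cong en (toFront-suc ℓ₂ k)) (half (k ≟ j))
        where
        half : Dec (k ≡ j) → SameEnds (en (punchIn ℓ₂ k)) (mapPair σ (ends GQ (suc k)))
        half (yes refl) = SameEnds-≡ˡ (cong en (punchIn-punchOut (ℓ₁≢ℓ₂ ∘ sym)))
          (SameEnds-≡ʳ (cong (mapPair σ) (subdivide-ends-≡ P′ j j refl))
            (SameEnds-trans (Joins⇒SameEnds G j₁)
              (inj₂ (refl , trans (sym (punchIn-punchOut z≢x))
                                  (trans (cong (punchIn z ∘ proj₁) (sym (ends′-j (j ≟ j)))) (sym (toFront-suc z _)))))))
        half (no k≢j)   = SameEnds-≡ʳ (cong (mapPair σ) (subdivide-ends-≢ P′ j k k≢j))
          (SameEnds-≡ʳ (toFront-mapPair-suc z _) (SameEnds-≡ʳ (ends′-other k k≢j (k ≟ j)) (SameEnds-refl _)))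

Steps-snoc : ∀ {P Q R} → Steps P Q → Step Q R → Steps P R
Steps-snoc done        s = s then done
Steps-snoc (s′ then ss) s = s′ then Steps-snoc ss s

ObtainableFrom-step : ∀ {P Q P′ C} → Step P Q → Iso Q P′ → ObtainableFrom P C → ObtainableFrom P′ C
ObtainableFrom-step s I (R , steps , J) with Step-transport J s
... | R′ , s′ , J′ = R′ , Steps-snoc steps s′ , Iso-trans J′ I

Reduction-obtainable : ∀ {P C} (r : Reduction P) → (InG′ (Reduction.smaller r) → ObtainableFrom (Reduction.smaller r) C) →
                       InG′ P → ObtainableFrom P C
Reduction-obtainable r obtain inG = ObtainableFrom-step operation iso
  (obtain (InG′-reflect (Step⇒Contraction operation) (InG′-resp-Iso (Iso-sym iso) inG)))
  where open Reduction r

Fin2↔ : ∀ {n} {a b : Fin n} → a ≢ b → (∀ x → x ≡ a ⊎ x ≡ b) → Fin 2 ↔ Fin n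
Fin2↔ {n} {a} {b} a≢b cover = mk↔ₛ′ to from to-from from-to
  where
  to : Fin 2 → Fin n
  to zero       = a
  to (suc zero) = b
  from : Fin n → Fin 2
  from x with x ≟ a
  ... | yes _ = zero
  ... | no _  = suc zero
  to-from : ∀ x → to (from x) ≡ x
  to-from x with x ≟ a | cover x
  ... | yes x≡a | _        = sym x≡a
  ... | no x≢a  | inj₁ x≡a = ⊥-elim (x≢a x≡a)
  ... | no _    | inj₂ x≡b = sym x≡b
  from-to : ∀ i → from (to i) ≡ i
  from-to zero with a ≟ a
  ... | yes _   = refl
  ... | no a≢a = ⊥-elim (a≢a refl)
  from-to (suc zero) with b ≟ a
  ... | yes b≡a = ⊥-elim (a≢b (sym b≡a))
  ... | no _    = refl

module Configurations {nv ne : ℕ} (en : Fin (suc ne) → Fin (suc nv) × Fin (suc nv)) (d : Fin (suc ne)) where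
  open Reductions en d
  open DegreeThree G using (ThreeNeighbours; degreeThree⇒K4Model)

  V E : Set
  V = Fin (suc nv)
  E = Fin (suc ne)

  u v : V
  u = proj₁ (en d)
  v = proj₂ (en d)

  incident? : ∀ w k → Dec (Incident w k)
  incident? w k = proj₁ (en k) ≟ w ⊎-dec proj₂ (en k) ≟ w

  Reducible : Set
  Reducible = (Σ E λ ℓ → ℓ ≢ d × IsLoop G ℓ)
            ⊎ (Σ E λ ℓ → Σ E λ ℓ′ → ℓ ≢ ℓ′ × ℓ ≢ d × ℓ′ ≢ d × SameEnds (en ℓ) (en ℓ′))
            ⊎ (Σ V λ w → Σ E λ ℓ → Σ V λ o →
                 ℓ ≢ d × w ≢ o × Joins G ℓ w o × (∀ k → Incident w k → k ≡ ℓ))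
            ⊎ (Σ V λ z → Σ E λ ℓ₁ → Σ E λ ℓ₂ → Σ V λ x → Σ V λ y →
                 ℓ₁ ≢ ℓ₂ × ℓ₁ ≢ d × ℓ₂ ≢ d × z ≢ x × z ≢ y × Joins G ℓ₁ z x × Joins G ℓ₂ z y ×
                 (∀ k → Incident z k → k ≡ ℓ₁ ⊎ k ≡ ℓ₂))

  reducible? : Dec Reducible
  reducible? =
    any? (λ ℓ → ¬? (ℓ ≟ d) ×-dec proj₁ (en ℓ) ≟ proj₂ (en ℓ))
    ⊎-dec any? (λ ℓ → any? λ ℓ′ →
                 ¬? (ℓ ≟ ℓ′) ×-dec ¬? (ℓ ≟ d) ×-dec ¬? (ℓ′ ≟ d) ×-dec sameEnds? (en ℓ) (en ℓ′))
    ⊎-dec any? (λ w → any? λ ℓ → any? λ o → ¬? (ℓ ≟ d) ×-dec ¬? (w ≟ o) ×-dec joins? ℓ w o ×-dec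
                 all? (λ k → incident? w k →-dec k ≟ ℓ))
    ⊎-dec any? (λ z → any? λ ℓ₁ → any? λ ℓ₂ → any? λ x → any? λ y →
                 ¬? (ℓ₁ ≟ ℓ₂) ×-dec ¬? (ℓ₁ ≟ d) ×-dec ¬? (ℓ₂ ≟ d) ×-dec ¬? (z ≟ x) ×-dec ¬? (z ≟ y) ×-dec
                 joins? ℓ₁ z x ×-dec joins? ℓ₂ z y ×-dec all? (λ k → incident? z k →-dec (k ≟ ℓ₁ ⊎-dec k ≟ ℓ₂)))
    where
    sameEnds? : ∀ (p q : V × V) → Dec (SameEnds p q)
    sameEnds? (a , b) (c , e) = (a ≟ c ×-dec b ≟ e) ⊎-dec (a ≟ e ×-dec b ≟ c)
    joins? : ∀ i x y → Dec (Joins G i x y)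
    joins? i x y = ≡-dec _≟_ _≟_ (en i) (x , y) ⊎-dec ≡-dec _≟_ _≟_ (en i) (y , x)

  reduction : Reducible → Reduction P
  reduction (inj₁ (ℓ , ℓ≢d , loop)) = loopReduction ℓ ℓ≢d loop
  reduction (inj₂ (inj₁ (ℓ , ℓ′ , ℓ≢ℓ′ , ℓ≢d , ℓ′≢d , same))) =
    parallelReduction ℓ ℓ′ ℓ≢ℓ′ ℓ≢d ℓ′≢d same
  reduction (inj₂ (inj₂ (inj₁ (w , ℓ , o , ℓ≢d , w≢o , joins , only)))) = leafReduction w ℓ o ℓ≢d w≢o joins only
  reduction (inj₂ (inj₂ (inj₂ (z , ℓ₁ , ℓ₂ , x , y , ℓ₁≢ℓ₂ , ℓ₁≢d , ℓ₂≢d , z≢x , z≢y , j₁ , j₂ , only)))) =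
    seriesReduction z ℓ₁ ℓ₂ x y ℓ₁≢ℓ₂ ℓ₁≢d ℓ₂≢d z≢x z≢y j₁ j₂ only

  module Irreducible (irreducible : ¬ Reducible) where

    module _ {w : V} (w≢u : w ≢ u) (w≢v : w ≢ v) where

      incident≢d : ∀ {k n} → Joins G k w n → k ≢ d
      incident≢d (inj₁ e) refl = w≢u (sym (cong proj₁ e))
      incident≢d (inj₂ e) refl = w≢v (sym (cong proj₂ e))

      neighbour≢ : ∀ {k n} → Joins G k w n → n ≢ w
      neighbour≢ {k} j refl = irreducible (inj₁ (k , incident≢d j , SameEnds-loop (SameEnds-sym (Joins⇒SameEnds G j))))

      notParallel : ∀ {k k′ n} → k ≢ k′ → Joins G k w n → Joins G k′ w n → ⊥
      notParallel k≢k′ j j′ = irreducible (inj₂ (inj₁ (_ , _ , k≢k′ , incident≢d j , incident≢d j′ ,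
                                SameEnds-trans (Joins⇒SameEnds G j) (SameEnds-sym (Joins⇒SameEnds G j′)))))

      incidentJoins : ∀ {k} → Incident w k → ∃ λ n → Joins G k w n
      incidentJoins {k} (inj₁ e) = proj₂ (en k) , inj₁ (cong (_, proj₂ (en k)) e)
      incidentJoins {k} (inj₂ e) = proj₁ (en k) , inj₂ (cong (proj₁ (en k) ,_) e)

      anotherEdge : ∀ {X : E → Set} → (∀ k → Dec (X k)) → ¬ (∀ k → Incident w k → X k) →
                    ∃ λ k → Incident w k × ¬ X k
      anotherEdge X? notAll with any? (λ k → incident? w k ×-dec ¬? (X? k))
      ... | yes found = found
      ... | no ¬found  = ⊥-elim (notAll λ k inc → decidable-stable (X? k) (λ ¬Xk → ¬found (k , inc , ¬Xk)))

      threeNeighbours : Connected G → ThreeNeighbours w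
      threeNeighbours (_ , walk) with walk w u
      ... | here _ = ⊥-elim (w≢u refl)
      ... | step ℓ₁ _ j₁ _ _
        with anotherEdge (_≟ ℓ₁) (λ only → irreducible (inj₂ (inj₂ (inj₁
               (w , ℓ₁ , _ , incident≢d j₁ , neighbour≢ j₁ ∘ sym , j₁ , only)))))
      ... | ℓ₂ , inc₂ , ℓ₂≢ℓ₁ with incidentJoins inc₂
      ... | n₂ , j₂
        with anotherEdge (λ k → k ≟ ℓ₁ ⊎-dec k ≟ ℓ₂) (λ only → irreducible (inj₂ (inj₂ (inj₂
               (w , ℓ₁ , ℓ₂ , _ , n₂ , ℓ₂≢ℓ₁ ∘ sym , incident≢d j₁ , incident≢d j₂ ,
                neighbour≢ j₁ ∘ sym , neighbour≢ j₂ ∘ sym , j₁ , j₂ , only)))))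
      ... | ℓ₃ , inc₃ , ℓ₃∉ with incidentJoins inc₃
      ... | n₃ , j₃ = record
        { w~n₁ = ℓ₁ , j₁ ; w~n₂ = ℓ₂ , j₂ ; w~n₃ = ℓ₃ , j₃
        ; n₁≢w = neighbour≢ j₁ ; n₂≢w = neighbour≢ j₂ ; n₃≢w = neighbour≢ j₃
        ; n₁≢n₂ = λ { refl → notParallel (ℓ₂≢ℓ₁ ∘ sym) j₁ j₂ }
        ; n₁≢n₃ = λ { refl → notParallel (ℓ₃∉ ∘ inj₁ ∘ sym) j₁ j₃ }
        ; n₂≢n₃ = λ { refl → notParallel (ℓ₃∉ ∘ inj₂ ∘ sym) j₂ j₃ } }

    module _ (u≢v : u ≢ v) (twoVertices : ∀ x → x ≡ u ⊎ x ≡ v) where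

      uvEdge : ∀ g → g ≢ d → SameEnds (en g) (u , v)
      uvEdge g g≢d with twoVertices (proj₁ (en g)) | twoVertices (proj₂ (en g))
      ... | inj₁ e₁ | inj₁ e₂ = ⊥-elim (irreducible (inj₁ (g , g≢d , trans e₁ (sym e₂))))
      ... | inj₁ e₁ | inj₂ e₂ = inj₁ (e₁ , e₂)
      ... | inj₂ e₁ | inj₁ e₂ = inj₂ (e₁ , e₂)
      ... | inj₂ e₁ | inj₂ e₂ = ⊥-elim (irreducible (inj₁ (g , g≢d , trans e₁ (sym e₂))))

      C₂e≅ : ∀ f → f ≢ d → Iso C₂e P
      C₂e≅ f f≢d = record
        { vIso = Fin2↔ u≢v twoVertices ; eIso = Fin2↔ (f≢d ∘ sym) twoEdges ; ends≅ = ends≅ ; dist≅ = refl }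
        where
        twoEdges : ∀ g → g ≡ d ⊎ g ≡ f
        twoEdges g with g ≟ d | g ≟ f
        ... | yes g≡d | _       = inj₁ g≡d
        ... | no _    | yes g≡f = inj₂ g≡f
        ... | no g≢d  | no g≢f  = ⊥-elim (irreducible (inj₂ (inj₁ (f , g , g≢f ∘ sym , f≢d , g≢d ,
                                    SameEnds-trans (uvEdge f f≢d) (SameEnds-sym (uvEdge g g≢d))))))
        ends≅ : ∀ i → SameEnds (en (Fin2↔ (f≢d ∘ sym) twoEdges ⟨$⟩ʳ i)) (u , v)
        ends≅ zero       = SameEnds-refl _
        ends≅ (suc zero) = uvEdge f f≢d

    obtainable : InG′ P → ObtainableFrom P C₂e
    obtainable (connected , seriesParallel , ¬bridge , ¬loop) with any? (λ w → ¬? (w ≟ u) ×-dec ¬? (w ≟ v))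
    ... | yes third = ⊥-elim (seriesParallel
                        (degreeThree⇒K4Model (inj₁ refl) ¬loop (λ w≢u w≢v → threeNeighbours w≢u w≢v connected) third))
    ... | no noThird with any? (λ f → ¬? (f ≟ d))
    ...   | yes (f , f≢d) = C₂e , done , C₂e≅ ¬loop twoVertices f f≢d
      where
      twoVertices : ∀ x → x ≡ u ⊎ x ≡ v
      twoVertices x with x ≟ u | x ≟ v
      ... | yes x≡u | _       = inj₁ x≡u
      ... | no _    | yes x≡v = inj₂ x≡v
      ... | no x≢u  | no x≢v  = ⊥-elim (noThird (x , x≢u , x≢v))
    ...   | no onlyD = ⊥-elim (¬bridge (noWalk ¬loop))
      where
      noWalk : ∀ {x y} → x ≢ y → ¬ Walk G (AllV G) (λ i → i ≢ d) x y
      noWalk x≢y (here _)            = x≢y refl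
      noWalk _   (step i i≢d _ _ _) = onlyD (i , i≢d)

obtainable : ∀ P → Acc _<_ (nE (graph P)) → InG′ P → ObtainableFrom P C₂e
obtainable record { graph = record { nV = zero ; ends = en } ; dist = d } _ _ with proj₁ (en d)
... | ()
obtainable record { graph = record { nV = suc nv ; nE = zero } ; dist = () } _ _
obtainable record { graph = record { nV = suc nv ; nE = suc ne ; ends = en } ; dist = d } (acc smaller) inG
  with Configurations.reducible? en d
... | yes r  = Reduction-obtainable (Configurations.reduction en d r)
                 (obtainable _ (smaller (Reduction.fewer (Configurations.reduction en d r)))) inG
... | no ¬r = Configurations.Irreducible.obtainable en d ¬r inG

lemma2p2 : (P : Pointed) → InG′ P → ObtainableFrom P C₂e
lemma2p2 P = obtainable P (<-wellFounded (nE (graph P)))
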